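{- Let $n \ge 2$ and let $H = (h_{ij})$, indexed by unordered pairs $\{i,j\}$ of distinct elements of $[n]$ (so $h_{ij}=h_{ji}$), where each $h_{ij}$ is either an element of $\mathbf{R}\cup\{+\infty\}$ ("defined") or "undefined". Assume that $h_{ij} \ge 0$ for every defined $h_{ij}$, and that $h_{ij} \ge \min\{h_{jk}, h_{ik}\}$ whenever $i,j,k$ are distinct and $h_{ij}, h_{jk}, h_{ik}$ are all defined. Let $G_H = ([n], E_H; w)$ be the edge-weighted graph with $E_H = \{\{i,j\} : i \ne j,\ h_{ij} \text{ defined}\}$ and $w(\{i,j\}) = h_{ij}$. Then $H$ is M${}^\natural$-convex completable if and only if for every chordless cycle $C$ of $G_H$, the minimum of $w$ over the edges of $C$ is attained by at least two distinct edges of $C$.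
   Context: Conventions: $a<+\infty$, $a+(+\infty)=+\infty$ for $a\in\mathbf{R}$, $0\cdot(+\infty)=0$. A function $f : \{0,1\}^n \to \mathbf{R}\cup\{+\infty\}$ is M${}^\natural$-convex if for all $x,y \in \{0,1\}^n$ and all $i$ with $x_i > y_i$ there exists $j \in \{j : y_j > x_j\} \cup \{0\}$ such that $f(x)+f(y) \ge f(x-\chi_i+\chi_j)+f(y+\chi_i-\chi_j)$, where $\chi_i$ is the $i$-th unit vector and $\chi_0 = 0$. $H$ is called M${}^\natural$-convex completable if one can assign values in $\mathbf{R}\cup\{+\infty\}$ to all undefined entries (keeping symmetry) so that, for the resulting fully defined $(h_{ij})$ and some real numbers $h_1,\dots,h_n$, the function $f(x) = \sum_{i} h_i x_i + \sum_{i<j} h_{ij} x_i x_j$ on $\{0,1\}^n$ is M${}^\natural$-convex. A chordless cycle of a graph is a cycle (of length at least 3) such that no edge of the graph joins two non-consecutive vertices of the cycle. -}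

module Defs where

open import Level using (0ℓ)
open import Data.Nat using (ℕ; zero; suc)
open import Data.Nat.DivMod using (_mod_)
open import Data.Fin using (Fin; toℕ)
open import Data.Bool using (Bool; true; false; _∧_; if_then_else_)
open import Data.Maybe using (Maybe; just; nothing)
open import Data.Product using (Σ; ∃; _×_; _,_)
open import Data.Sum using (_⊎_)
open import Relation.Binary.PropositionalEquality using (_≡_)
open import Relation.Nullary using (¬_)
open import Relation.Binary.Structures using (IsTotalOrder)
open import Algebra.Structures using (IsCommutativeRing)
open import Relation.Nullary.Decidable using (⌊_⌋)
open import Data.Fin using (_≟_)
import Data.Nat as N
import Data.Fin as F

-- The real numbers, axiomatised as a (Dedekind-)complete ordered field.

record RealField : Set₁ where
  infixl 6 _+_
  infixl 7 _*_
  infix 4 _≤_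
  field
    Carrier : Set
    _+_ _*_ : Carrier → Carrier → Carrier
    -_      : Carrier → Carrier
    0# 1#   : Carrier
    _≤_     : Carrier → Carrier → Set
    isCommutativeRing : IsCommutativeRing _≡_ _+_ _*_ -_ 0# 1#
    0≢1     : ¬ (0# ≡ 1#)
    inverse : ∀ x → ¬ (x ≡ 0#) → ∃ λ y → x * y ≡ 1#
    isTotalOrder : IsTotalOrder _≡_ _≤_
    +-mono-≤ : ∀ {x y} z → x ≤ y → x + z ≤ y + z
    *-nonneg : ∀ {x y} → 0# ≤ x → 0# ≤ y → 0# ≤ x * y
    sup : (P : Carrier → Set) → (∃ λ x → P x) →
          (∃ λ b → ∀ x → P x → x ≤ b) →
          ∃ λ s → (∀ x → P x → x ≤ s) × (∀ b → (∀ x → P x → x ≤ b) → s ≤ b)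

module _ (ℝ : RealField) where
  open RealField ℝ renaming (Carrier to R)

  data Ext : Set where
    fin : R → Ext
    +∞  : Ext

  infix 4 _≤ᵉ_
  data _≤ᵉ_ : Ext → Ext → Set where
    fin≤fin : ∀ {a b} → a ≤ b → fin a ≤ᵉ fin b
    ≤+∞     : ∀ {x} → x ≤ᵉ +∞

  infixl 6 _+ᵉ_
  _+ᵉ_ : Ext → Ext → Ext
  fin a +ᵉ fin b = fin (a + b)
  fin _ +ᵉ +∞    = +∞
  +∞    +ᵉ _     = +∞

  sumᵉ : ∀ {n} → (Fin n → Ext) → Ext
  sumᵉ {zero}  g = fin 0#
  sumᵉ {suc n} g = g F.zero +ᵉ sumᵉ (λ i → g (F.suc i))

  -- 0·(+∞) = 0 convention: multiplication by a 0/1 value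
  ifᵉ : Bool → Ext → Ext
  ifᵉ b e = if b then e else fin 0#

  -- a partially defined symmetric "matrix": nothing = undefined
  PartialMatrix : ℕ → Set
  PartialMatrix n = Fin n → Fin n → Maybe Ext

  quadFun : ∀ {n} → (Fin n → R) → (Fin n → Fin n → Ext) → (Fin n → Bool) → Ext
  quadFun h K x =
    sumᵉ (λ i → ifᵉ (x i) (fin (h i))) +ᵉ
    sumᵉ (λ i → sumᵉ (λ j → ifᵉ (x i ∧ x j ∧ ⌊ toℕ i N.<? toℕ j ⌋) (K i j)))

  set : ∀ {n} → (Fin n → Bool) → Fin n → Bool → (Fin n → Bool)
  set x i b k = if ⌊ k ≟ i ⌋ then b else x k

  IsMnatConvex : ∀ {n} → ((Fin n → Bool) → Ext) → Set
  IsMnatConvex {n} f =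
    ∀ (x y : Fin n → Bool) (i : Fin n) → x i ≡ true → y i ≡ false →
      (f (set x i false) +ᵉ f (set y i true) ≤ᵉ f x +ᵉ f y)      -- j = 0
      ⊎ (Σ (Fin n) λ j → y j ≡ true × x j ≡ false ×
          (f (set (set x i false) j true) +ᵉ f (set (set y i true) j false)
             ≤ᵉ f x +ᵉ f y))

  Completable : ∀ {n} → PartialMatrix n → Set
  Completable {n} H =
    Σ (Fin n → Fin n → Ext) λ K →
      (∀ i j → ¬ (i ≡ j) → K i j ≡ K j i) ×
      (∀ i j → ¬ (i ≡ j) → ∀ v → H i j ≡ just v → K i j ≡ v) ×
      Σ (Fin n → R) λ h → IsMnatConvex (quadFun h K)

  SymmetricPM : ∀ {n} → PartialMatrix n → Set
  SymmetricPM {n} H = ∀ (i j : Fin n) → ¬ (i ≡ j) → H i j ≡ H j i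

  NonnegPM : ∀ {n} → PartialMatrix n → Set
  NonnegPM {n} H = ∀ (i j : Fin n) → ¬ (i ≡ j) → ∀ v → H i j ≡ just v → fin 0# ≤ᵉ v

  UltraPM : ∀ {n} → PartialMatrix n → Set
  UltraPM {n} H = ∀ (i j k : Fin n) → ¬ (i ≡ j) → ¬ (j ≡ k) → ¬ (i ≡ k) →
    ∀ a b c → H i j ≡ just a → H j k ≡ just b → H i k ≡ just c →
    (b ≤ᵉ a ⊎ c ≤ᵉ a)

  next : ∀ {m} → Fin (suc m) → Fin (suc m)
  next {m} a = suc (toℕ a) mod suc m

  -- A chordless cycle v_0 … v_m (length suc m ≥ 3) of G_H, with edge weights
  -- w a = h_{v_a v_{a+1}} (indices mod suc m).
  record ChordlessCycle {n} (H : PartialMatrix n) : Set where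
    field
      m      : ℕ
      len≥3  : 3 N.≤ suc m
      v      : Fin (suc m) → Fin n
      v-inj  : ∀ a b → v a ≡ v b → a ≡ b
      w      : Fin (suc m) → Ext
      edge   : ∀ a → H (v a) (v (next a)) ≡ just (w a)
      chordless : ∀ a b → ¬ (a ≡ b) → ¬ (b ≡ next a) → ¬ (a ≡ next b) →
                  H (v a) (v b) ≡ nothing

  MinTwice : ∀ {n} {H : PartialMatrix n} → ChordlessCycle H → Set
  MinTwice C = Σ (Fin (suc m)) λ a → Σ (Fin (suc m)) λ b → ¬ (a ≡ b) ×
      (∀ c → w a ≤ᵉ w c) × (∀ c → w b ≤ᵉ w c)
    where open ChordlessCycle C

module Submission where

-- The pivot is a characterisation of the completions themselves: for a symmetric
-- matrix K ≥ 0, the quadratic function f = quadFun h K is M♮-convex exactly when K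
-- satisfies the ultrametric-type inequality K x z ≥ min (K x y) (K y z) on distinct
-- x, y, z.  "If" (ultra⇒M♮-convex) comes from an exchange lemma for the pairwise
-- part of f, proved by induction on the size of x; "only if" (M♮-convex⇒ultra) is
-- the exchange axiom for x = {a, c}, y = {b}.  Both rest on the formula for
-- inserting one element into the argument of f (QuadraticForm.f-insert).
--
-- Necessity: walking around a cycle of G_H, the ultrametric inequality shows that
-- every edge weighs at least the minimum of the other edges, so the minimum is
-- attained twice.  Sufficiency: the maximin (widest-path) closure K of H, computed
-- Floyd–Warshall style, is an ultrametric above H; it equals H on defined entries,
-- since a walk of G_H between the ends of an entry h can be shortened (removing
-- repeated vertices and chords) to a chordless cycle through that edge, whose
-- minimum is attained twice.

open import Defs
open import Data.Nat as ℕ using (ℕ; zero; suc; _+_; _∸_; _%_; _<_; _≤_; s≤s; z≤n)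
import Data.Nat.Properties as ℕₚ
open import Data.Nat.DivMod using (_mod_; m%n<n; m<n⇒m%n≡m; n%n≡0; %-distribˡ-+; m%n%n≡m%n; [m+n]%n≡m%n)
open import Data.Nat.Induction using (<-wellFounded)
open import Data.Fin as Fin using (Fin; toℕ; _≟_)
import Data.Fin.Properties as Finₚ
open import Data.Bool as Bool using (Bool; true; false; _∧_; if_then_else_)
import Data.Bool.Properties as Boolₚ
open import Data.Maybe using (Maybe; just; nothing)
open import Data.Maybe.Properties using (just-injective)
open import Data.List using (List; []; _∷_; allFin)
open import Data.List.Membership.Propositional using (_∈_)
open import Data.List.Membership.Propositional.Properties using (∈-allFin)
open import Data.List.Relation.Unary.Any using (here; there)
open import Data.Product using (Σ; ∃; ∃₂; _×_; _,_; proj₁; proj₂)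
open import Data.Sum using (_⊎_; inj₁; inj₂)
open import Data.Empty using (⊥-elim)
open import Data.Unit using (⊤; tt)
open import Function using (_∘_)
open import Function.Bundles using (_⇔_; mk⇔)
open import Relation.Binary.PropositionalEquality
open import Relation.Binary.Definitions using (tri<; tri≈; tri>)
open import Relation.Binary.Structures using (IsTotalOrder)
open import Relation.Binary.Bundles using (TotalOrder; TotalPreorder)
open import Relation.Binary.Construct.Flip.EqAndOrd using () renaming (totalPreorder to flipped)
import Relation.Binary.Construct.On as On
open import Relation.Nullary using (¬_; yes; no; Dec; does)
open import Relation.Nullary.Decidable using (⌊_⌋; isYes≗does; dec-true; dec-false; _×-dec_; ¬?)
open import Relation.Unary using (Pred; Decidable)
open import Induction.WellFounded using (module All)
open import Algebra.Structures using (IsCommutativeRing)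
open import Algebra.Bundles using (CommutativeMonoid)
import Algebra.Properties.CommutativeSemigroup as CommSemigroupProperties
import Algebra.Construct.NaturalChoice.Min as NaturalMin
import Algebra.Construct.NaturalChoice.Max as NaturalMax

anyPairUpTo? : ∀ {p} {P : ℕ → ℕ → Set p} → (∀ a b → Dec (P a b)) → ∀ L →
               Dec (∃₂ λ a b → a < b × b ≤ L × P a b)
anyPairUpTo? P? L with ℕₚ.anyUpTo? (λ b → ℕₚ.anyUpTo? (λ a → P? a b) b) (suc L)
... | yes (b , s≤s b≤L , a , a<b , pab) = yes (a , b , a<b , b≤L , pab)
... | no none = no λ (a , b , a<b , b≤L , pab) → none (b , s≤s b≤L , a , a<b , pab)

all-or-escape : ∀ {p q} {P : ℕ → Set p} {B : Set q} L →
                (∀ a → a < L → P a ⊎ B) → (∀ a → a < L → P a) ⊎ B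
all-or-escape zero f = inj₁ λ a ()
all-or-escape {P = P} {B} (suc L) f
  with all-or-escape L (λ a a<L → f a (ℕₚ.m≤n⇒m≤1+n a<L)) | f L ℕₚ.≤-refl
... | inj₂ b     | _      = inj₂ b
... | inj₁ _     | inj₂ b = inj₂ b
... | inj₁ below | inj₁ atL = inj₁ everywhere
  where
  everywhere : ∀ a → a < suc L → P a
  everywhere a (s≤s a≤L) with ℕₚ.m≤n⇒m<n∨m≡n a≤L
  ... | inj₁ a<L = below a a<L
  ... | inj₂ refl = atL

-- A walk of length L is a vertex sequence indexed by positions 0 … L (positions
-- beyond L are ignored); indexing by ℕ makes sub-walks and concatenation easy.
module Walks {V : Set} (Edge : V → V → Set) where

  record Walk (i j : V) : Set where
    field
      len        : ℕ
      vertex     : ℕ → V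
      vertex-0   : vertex 0 ≡ i
      vertex-len : vertex len ≡ j
      step       : ∀ a → a < len → Edge (vertex a) (vertex (suc a))

  open Walk public

  Interior : (V → Set) → ∀ {i j} → Walk i j → Set
  Interior S w = ∀ a → 0 < a → a < len w → S (vertex w a)

  interior-mono : ∀ {S S′ : V → Set} → (∀ {x} → S x → S′ x) → ∀ {i j} (w : Walk i j) →
                  Interior S w → Interior S′ w
  interior-mono S⊆S′ w I a 0<a a<len = S⊆S′ (I a 0<a a<len)

  edge-walk : ∀ {i j} → Edge i j → Walk i j
  edge-walk {i} {j} e = record
    { len = 1 ; vertex = endpoints ; vertex-0 = refl ; vertex-len = refl ; step = only-step }
    where
    endpoints : ℕ → V
    endpoints zero    = i
    endpoints (suc _) = j
    only-step : ∀ a → a < 1 → Edge (endpoints a) (endpoints (suc a))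
    only-step zero _ = e
    only-step (suc a) (s≤s ())

  edge-walk-interior : ∀ S {i j} (e : Edge i j) → Interior S (edge-walk e)
  edge-walk-interior S e zero () _
  edge-walk-interior S e (suc a) _ (s≤s ())

  module Concat {i k j} (w₁ : Walk i k) (w₂ : Walk k j) where
    L₁ : ℕ
    L₁ = len w₁

    glued : ℕ → V
    glued a with a ℕ.≤? L₁
    ... | yes _ = vertex w₁ a
    ... | no  _ = vertex w₂ (a ∸ L₁)

    glued-left : ∀ a → a ≤ L₁ → glued a ≡ vertex w₁ a
    glued-left a a≤L₁ with a ℕ.≤? L₁
    ... | yes _ = refl
    ... | no a≰L₁ = ⊥-elim (a≰L₁ a≤L₁)

    glued-right : ∀ c → glued (L₁ + c) ≡ vertex w₂ c
    glued-right c with (L₁ + c) ℕ.≤? L₁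
    ... | no _ = cong (vertex w₂) (ℕₚ.m+n∸m≡n L₁ c)
    ... | yes le
      with ℕₚ.n≤0⇒n≡0 (ℕₚ.+-cancelˡ-≤ L₁ c 0 (subst (L₁ + c ≤_) (sym (ℕₚ.+-identityʳ L₁)) le))
    ...   | refl = trans (cong (vertex w₁) (ℕₚ.+-identityʳ L₁))
                         (trans (vertex-len w₁) (sym (vertex-0 w₂)))

    position : ∀ a → a < L₁ ⊎ Σ ℕ (λ c → a ≡ L₁ + c)
    position a with a ℕ.<? L₁
    ... | yes a<L₁ = inj₁ a<L₁
    ... | no a≮L₁ = inj₂ (a ∸ L₁ , sym (ℕₚ.m+[n∸m]≡n (ℕₚ.≮⇒≥ a≮L₁)))

    glued-step : ∀ a → a < L₁ + len w₂ → Edge (glued a) (glued (suc a))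
    glued-step a a<len with position a
    ... | inj₁ a<L₁ = subst₂ Edge (sym (glued-left a (ℕₚ.<⇒≤ a<L₁)))
                                  (sym (glued-left (suc a) a<L₁)) (step w₁ a a<L₁)
    ... | inj₂ (c , refl) =
      subst₂ Edge (sym (glued-right c))
                  (sym (trans (cong glued (sym (ℕₚ.+-suc L₁ c))) (glued-right (suc c))))
                  (step w₂ c (ℕₚ.+-cancelˡ-< L₁ c (len w₂) a<len))

    concat : Walk i j
    concat = record
      { len = L₁ + len w₂ ; vertex = glued
      ; vertex-0 = trans (glued-left 0 z≤n) (vertex-0 w₁)
      ; vertex-len = trans (glued-right (len w₂)) (vertex-len w₂)
      ; step = glued-step }

    concat-interior : ∀ S → Interior S w₁ → Interior S w₂ → S k → Interior S concat
    concat-interior S I₁ I₂ Sk a 0<a a<len with position a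
    ... | inj₁ a<L₁ = subst S (sym (glued-left a (ℕₚ.<⇒≤ a<L₁))) (I₁ a 0<a a<L₁)
    ... | inj₂ (zero , refl) =
      subst S (sym (trans (glued-right 0) (vertex-0 w₂))) Sk
    ... | inj₂ (suc c , refl) =
      subst S (sym (glued-right (suc c))) (I₂ (suc c) (s≤s z≤n) (ℕₚ.+-cancelˡ-< L₁ (suc c) (len w₂) a<len))

  open Concat public using (concat; concat-interior)

  subwalk : ∀ {i j x y} (w : Walk i j) l r → l ≤ r → r ≤ len w →
            vertex w l ≡ x → vertex w r ≡ y → Walk x y
  subwalk w l r l≤r r≤len wl wr = record
    { len = r ∸ l ; vertex = λ c → vertex w (l + c)
    ; vertex-0 = trans (cong (vertex w) (ℕₚ.+-identityʳ l)) wl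
    ; vertex-len = trans (cong (vertex w) (ℕₚ.m+[n∸m]≡n l≤r)) wr
    ; step = λ a a<r∸l → subst (λ z → Edge (vertex w (l + a)) (vertex w z)) (sym (ℕₚ.+-suc l a))
                           (step w (l + a) (inside a a<r∸l)) }
    where
    inside : ∀ a → a < r ∸ l → l + a < len w
    inside a a<r∸l = ℕₚ.<-≤-trans (subst (l + a <_) (ℕₚ.m+[n∸m]≡n l≤r) (ℕₚ.+-monoʳ-< l a<r∸l)) r≤len

  subwalk-interior : ∀ S {i j x y} (w : Walk i j) l r (l≤r : l ≤ r) (r≤len : r ≤ len w)
                     (wl : vertex w l ≡ x) (wr : vertex w r ≡ y) →
                     Interior S w → Interior S (subwalk w l r l≤r r≤len wl wr)
  subwalk-interior S w l r l≤r r≤len wl wr I a 0<a a<r∸l =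
    I (l + a) (ℕₚ.<-≤-trans 0<a (ℕₚ.m≤n+m a l))
      (ℕₚ.<-≤-trans (subst (l + a <_) (ℕₚ.m+[n∸m]≡n l≤r) (ℕₚ.+-monoʳ-< l a<r∸l)) r≤len)

  excise : ∀ {i j} (w : Walk i j) a b → a ≤ b → b ≤ len w → vertex w a ≡ vertex w b →
           Σ (Walk i j) λ w′ → len w′ ≡ a + (len w ∸ b)
  excise w a b a≤b b≤len wa≡wb =
    concat (subwalk w 0 a z≤n (ℕₚ.≤-trans a≤b b≤len) (vertex-0 w) refl)
           (subwalk w b (len w) b≤len ℕₚ.≤-refl (sym wa≡wb) (vertex-len w)) , refl

  bypass : ∀ {i j} (w : Walk i j) s r → s ≤ r → r ≤ len w → Edge (vertex w s) (vertex w r) →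
           Σ (Walk i j) λ w′ → len w′ ≡ s + suc (len w ∸ r)
  bypass w s r s≤r r≤len e =
    concat (subwalk w 0 s z≤n (ℕₚ.≤-trans s≤r r≤len) (vertex-0 w) refl)
           (concat (edge-walk e) (subwalk w r (len w) r≤len ℕₚ.≤-refl refl (vertex-len w))) , refl

module Extremum {c ℓ₁ ℓ₂} (O : TotalPreorder c ℓ₁ ℓ₂) where
  open TotalPreorder O using (_≲_; total) renaming (Carrier to A; refl to ≲-refl; trans to ≲-trans)

  argmax : ∀ {n p} {P : Pred (Fin n) p} → Decidable P → (g : Fin n → A) → ∃ P →
           Σ (Fin n) λ m → P m × (∀ k → P k → g k ≲ g m)
  argmax {suc n} {P = P} P? g witness with Finₚ.any? (P? ∘ Fin.suc)
  ... | no none = Fin.zero , P0 witness , best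
    where
    P0 : ∃ P → P Fin.zero
    P0 (Fin.zero , p0) = p0
    P0 (Fin.suc k , pk) = ⊥-elim (none (k , pk))
    best : ∀ k → P k → g k ≲ g Fin.zero
    best Fin.zero _ = ≲-refl
    best (Fin.suc k) pk = ⊥-elim (none (k , pk))
  ... | yes tailWitness with argmax (P? ∘ Fin.suc) (g ∘ Fin.suc) tailWitness | P? Fin.zero
  ...   | m , pm , best | no ¬p0 = Fin.suc m , pm , best′
    where
    best′ : ∀ k → P k → g k ≲ g (Fin.suc m)
    best′ Fin.zero p0 = ⊥-elim (¬p0 p0)
    best′ (Fin.suc k) pk = best k pk
  ...   | m , pm , best | yes p0 with total (g Fin.zero) (g (Fin.suc m))
  ...     | inj₁ g0≲gm = Fin.suc m , pm , best′
    where
    best′ : ∀ k → P k → g k ≲ g (Fin.suc m)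
    best′ Fin.zero _ = g0≲gm
    best′ (Fin.suc k) pk = best k pk
  ...     | inj₂ gm≲g0 = Fin.zero , p0 , best′
    where
    best′ : ∀ k → P k → g k ≲ g Fin.zero
    best′ Fin.zero _ = ≲-refl
    best′ (Fin.suc k) pk = ≲-trans (best k pk) gm≲g0

module _ (ℝ : RealField) where

  open RealField ℝ using (0#; isCommutativeRing; isTotalOrder; +-mono-≤) renaming (Carrier to R)

  private module Real = RealField ℝ
  open IsCommutativeRing isCommutativeRing
    using (+-assoc; +-comm; +-identityˡ; +-identityʳ; -‿inverseʳ)
  open IsTotalOrder isTotalOrder
    using () renaming (refl to ≤-refl; trans to ≤-trans; antisym to ≤-antisym; total to ≤-total)

  E : Set
  E = Ext ℝ

  infix 4 _≤e_
  _≤e_ : E → E → Set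
  _≤e_ = _≤ᵉ_ ℝ

  infixl 6 _⊕_
  _⊕_ : E → E → E
  _⊕_ = _+ᵉ_ ℝ

  𝟘 : E
  𝟘 = fin 0#

  ≤e-isTotalOrder : IsTotalOrder _≡_ _≤e_
  ≤e-isTotalOrder = record
    { isPartialOrder = record
      { isPreorder = record { isEquivalence = isEquivalence ; reflexive = reflexive ; trans = trans′ }
      ; antisym = antisym }
    ; total = total }
    where
    reflexive : ∀ {x y} → x ≡ y → x ≤e y
    reflexive {fin a} refl = fin≤fin ≤-refl
    reflexive {+∞}    refl = ≤+∞
    trans′ : ∀ {x y z} → x ≤e y → y ≤e z → x ≤e z
    trans′ (fin≤fin p) (fin≤fin q) = fin≤fin (≤-trans p q)
    trans′ _ ≤+∞ = ≤+∞
    antisym : ∀ {x y} → x ≤e y → y ≤e x → x ≡ y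
    antisym (fin≤fin p) (fin≤fin q) = cong fin (≤-antisym p q)
    antisym ≤+∞ ≤+∞ = refl
    total : ∀ x y → x ≤e y ⊎ y ≤e x
    total (fin a) (fin b) with ≤-total a b
    ... | inj₁ p = inj₁ (fin≤fin p)
    ... | inj₂ p = inj₂ (fin≤fin p)
    total (fin a) +∞ = inj₁ ≤+∞
    total +∞ y = inj₂ ≤+∞

  ≤e-totalOrder : TotalOrder _ _ _
  ≤e-totalOrder = record { isTotalOrder = ≤e-isTotalOrder }

  open IsTotalOrder ≤e-isTotalOrder
    using () renaming (refl to ≤e-refl; reflexive to ≤e-reflexive; trans to ≤e-trans;
                       antisym to ≤e-antisym; total to ≤e-total)

  ⊕-commutativeMonoid : CommutativeMonoid _ _
  ⊕-commutativeMonoid = record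
    { Carrier = E ; _≈_ = _≡_ ; _∙_ = _⊕_ ; ε = 𝟘
    ; isCommutativeMonoid = record
      { isMonoid = record
        { isSemigroup = record
          { isMagma = record { isEquivalence = isEquivalence ; ∙-cong = cong₂ _⊕_ }
          ; assoc = assoc }
        ; identity = identityˡ , λ x → trans (comm x 𝟘) (identityˡ x) }
      ; comm = comm } }
    where
    assoc : ∀ x y z → (x ⊕ y) ⊕ z ≡ x ⊕ (y ⊕ z)
    assoc (fin a) (fin b) (fin c) = cong fin (+-assoc a b c)
    assoc (fin a) (fin b) +∞ = refl
    assoc (fin a) +∞ z = refl
    assoc +∞ y z = refl
    comm : ∀ x y → x ⊕ y ≡ y ⊕ x
    comm (fin a) (fin b) = cong fin (+-comm a b)
    comm (fin a) +∞ = refl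
    comm +∞ (fin b) = refl
    comm +∞ +∞ = refl
    identityˡ : ∀ x → 𝟘 ⊕ x ≡ x
    identityˡ (fin a) = cong fin (+-identityˡ a)
    identityˡ +∞ = refl

  open CommutativeMonoid ⊕-commutativeMonoid
    using () renaming (assoc to ⊕-assoc; comm to ⊕-comm; identityˡ to ⊕-identityˡ;
                       identityʳ to ⊕-identityʳ; commutativeSemigroup to ⊕-commutativeSemigroup)
  open CommSemigroupProperties ⊕-commutativeSemigroup using (interchange)

  open import Algebra.Solver.CommutativeMonoid ⊕-commutativeMonoid using (solve; _⊜_) renaming (_⊕_ to _⊞_)

  ⊕-monoˡ : ∀ {x y} z → x ≤e y → x ⊕ z ≤e y ⊕ z
  ⊕-monoˡ (fin c) (fin≤fin p) = fin≤fin (+-mono-≤ c p)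
  ⊕-monoˡ +∞ (fin≤fin p) = ≤+∞
  ⊕-monoˡ z ≤+∞ = ≤+∞

  ⊕-monoʳ : ∀ {x y} z → x ≤e y → z ⊕ x ≤e z ⊕ y
  ⊕-monoʳ {x} {y} z p = subst₂ _≤e_ (⊕-comm x z) (⊕-comm y z) (⊕-monoˡ z p)

  ⊕-mono : ∀ {x y u v} → x ≤e y → u ≤e v → x ⊕ u ≤e y ⊕ v
  ⊕-mono {y = y} {u} p q = ≤e-trans (⊕-monoˡ u p) (⊕-monoʳ y q)

  ⊕-cancelʳ : ∀ {x y} c → x ⊕ fin c ≤e y ⊕ fin c → x ≤e y
  ⊕-cancelʳ {fin a} {fin b} c (fin≤fin p) =
    fin≤fin (subst₂ Real._≤_ (add-sub a) (add-sub b) (+-mono-≤ (Real.- c) p))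
    where
    add-sub : ∀ a → (a Real.+ c) Real.+ (Real.- c) ≡ a
    add-sub a = trans (+-assoc a c (Real.- c)) (trans (cong (a Real.+_) (-‿inverseʳ c)) (+-identityʳ a))
  ⊕-cancelʳ {fin a} {+∞} c p = ≤+∞
  ⊕-cancelʳ {+∞} {+∞} c p = ≤+∞

  ⊕-nonneg : ∀ {x y} → 𝟘 ≤e x → 𝟘 ≤e y → 𝟘 ≤e x ⊕ y
  ⊕-nonneg {x} {y} p q = subst (_≤e x ⊕ y) (⊕-identityˡ 𝟘) (⊕-mono p q)

  open NaturalMin ≤e-totalOrder using (_⊓_; x⊓y≤x; x⊓y≤y; ⊓-glb; ⊓-sel; ⊓-comm)
  open NaturalMax ≤e-totalOrder using (_⊔_; x≤x⊔y; x≤y⊔x; ⊔-lub; ⊔-sel)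

  ≤-⊔-split : ∀ {t} x y → t ≤e x ⊔ y → t ≤e x ⊎ t ≤e y
  ≤-⊔-split x y t≤ with ⊔-sel x y
  ... | inj₁ eq = inj₁ (subst (_ ≤e_) eq t≤)
  ... | inj₂ eq = inj₂ (subst (_ ≤e_) eq t≤)

  sum : ∀ {n} → (Fin n → E) → E
  sum = sumᵉ ℝ

  sum-cong : ∀ {n} {g g′ : Fin n → E} → (∀ k → g k ≡ g′ k) → sum g ≡ sum g′
  sum-cong {zero}  eq = refl
  sum-cong {suc n} eq = cong₂ _⊕_ (eq Fin.zero) (sum-cong (λ k → eq (Fin.suc k)))

  sum-mono : ∀ {n} {g g′ : Fin n → E} → (∀ k → g k ≤e g′ k) → sum g ≤e sum g′
  sum-mono {zero}  le = ≤e-refl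
  sum-mono {suc n} le = ⊕-mono (le Fin.zero) (sum-mono (λ k → le (Fin.suc k)))

  sum-nonneg : ∀ {n} {g : Fin n → E} → (∀ k → 𝟘 ≤e g k) → 𝟘 ≤e sum g
  sum-nonneg {zero}  nn = ≤e-refl
  sum-nonneg {suc n} nn = ⊕-nonneg (nn Fin.zero) (sum-nonneg (λ k → nn (Fin.suc k)))

  sum-zero : ∀ {n} {g : Fin n → E} → (∀ k → g k ≡ 𝟘) → sum g ≡ 𝟘
  sum-zero {zero}  z = refl
  sum-zero {suc n} z = trans (cong₂ _⊕_ (z Fin.zero) (sum-zero (λ k → z (Fin.suc k)))) (⊕-identityˡ 𝟘)

  sum-⊕ : ∀ {n} (g g′ : Fin n → E) → sum (λ k → g k ⊕ g′ k) ≡ sum g ⊕ sum g′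
  sum-⊕ {zero}  g g′ = sym (⊕-identityˡ 𝟘)
  sum-⊕ {suc n} g g′ =
    trans (cong (g Fin.zero ⊕ g′ Fin.zero ⊕_) (sum-⊕ (λ k → g (Fin.suc k)) (λ k → g′ (Fin.suc k))))
          (interchange (g Fin.zero) (g′ Fin.zero) _ _)

  sum-single : ∀ {n} (g : Fin n → E) i → (∀ k → ¬ (k ≡ i) → g k ≡ 𝟘) → sum g ≡ g i
  sum-single {suc n} g Fin.zero z =
    trans (cong (g Fin.zero ⊕_) (sum-zero (λ k → z (Fin.suc k) λ ()))) (⊕-identityʳ _)
  sum-single {suc n} g (Fin.suc i) z =
    trans (cong₂ _⊕_ (z Fin.zero λ ())
                     (sum-single (λ k → g (Fin.suc k)) i (λ k k≢i → z (Fin.suc k) (k≢i ∘ Finₚ.suc-injective))))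
          (⊕-identityˡ _)

  pointAt : ∀ {n} → Fin n → E → Fin n → E
  pointAt i c k = if does (k ≟ i) then c else 𝟘

  pointAt-same : ∀ {n} (i : Fin n) c → pointAt i c i ≡ c
  pointAt-same i c with i ≟ i
  ... | yes _ = refl
  ... | no i≢i = ⊥-elim (i≢i refl)

  pointAt-other : ∀ {n} (i : Fin n) c k → ¬ (k ≡ i) → pointAt i c k ≡ 𝟘
  pointAt-other i c k k≢i with k ≟ i
  ... | yes k≡i = ⊥-elim (k≢i k≡i)
  ... | no _ = refl

  sum-pointAt : ∀ {n} (i : Fin n) c → sum (pointAt i c) ≡ c
  sum-pointAt i c = trans (sum-single (pointAt i c) i (pointAt-other i c)) (pointAt-same i c)

  infixl 9 _[_]≔_
  _[_]≔_ : ∀ {n} → (Fin n → Bool) → Fin n → Bool → (Fin n → Bool)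
  x [ i ]≔ b = set ℝ x i b

  ≔-same : ∀ {n} (x : Fin n → Bool) i b → (x [ i ]≔ b) i ≡ b
  ≔-same x i b with i ≟ i
  ... | yes _ = refl
  ... | no i≢i = ⊥-elim (i≢i refl)

  ≔-other : ∀ {n} (x : Fin n → Bool) i b k → ¬ (k ≡ i) → (x [ i ]≔ b) k ≡ x k
  ≔-other x i b k k≢i with k ≟ i
  ... | yes k≡i = ⊥-elim (k≢i k≡i)
  ... | no _ = refl

  ≔-restore : ∀ {n} (x : Fin n → Bool) i b → x i ≡ b → ∀ k → (x [ i ]≔ b) k ≡ x k
  ≔-restore x i b xi k with k ≟ i
  ... | yes refl = sym xi
  ... | no _ = refl

  ≔-overwrite : ∀ {n} (x : Fin n → Bool) i b c → ∀ k → (x [ i ]≔ b [ i ]≔ c) k ≡ (x [ i ]≔ c) k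
  ≔-overwrite x i b c k with k ≟ i
  ... | yes _ = refl
  ... | no _ = refl

  ≔-comm : ∀ {n} (x : Fin n → Bool) {u v} b c → ¬ (u ≡ v) →
           ∀ k → (x [ u ]≔ b [ v ]≔ c) k ≡ (x [ v ]≔ c [ u ]≔ b) k
  ≔-comm x {u} {v} b c u≢v k with k ≟ u | k ≟ v
  ... | yes refl | yes refl = ⊥-elim (u≢v refl)
  ... | yes refl | no _ = refl
  ... | no _ | yes refl = refl
  ... | no _ | no _ = refl

  ifE : Bool → E → E
  ifE = ifᵉ ℝ

  sumOver : ∀ {n} → (Fin n → Bool) → (Fin n → E) → E
  sumOver P g = sum (λ k → ifE (P k) (g k))

  sumOver-cong : ∀ {n} {P Q : Fin n → Bool} (g : Fin n → E) → (∀ k → P k ≡ Q k) → sumOver P g ≡ sumOver Q g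
  sumOver-cong g eq = sum-cong (λ k → cong (λ b → ifE b (g k)) (eq k))

  sumOver-mono : ∀ {n} (P : Fin n → Bool) {g g′ : Fin n → E} →
                 (∀ k → P k ≡ true → g k ≤e g′ k) → sumOver P g ≤e sumOver P g′
  sumOver-mono P {g} {g′} le = sum-mono termwise
    where
    termwise : ∀ k → ifE (P k) (g k) ≤e ifE (P k) (g′ k)
    termwise k with P k in Pk
    ... | true  = le k Pk
    ... | false = ≤e-refl

  sumOver-empty : ∀ {n} {P : Fin n → Bool} (g : Fin n → E) → (∀ k → P k ≡ false) → sumOver P g ≡ 𝟘
  sumOver-empty g empty = sum-zero (λ k → cong (λ b → ifE b (g k)) (empty k))

  sumOver-nonneg : ∀ {n} (P : Fin n → Bool) (g : Fin n → E) →
                   (∀ k → P k ≡ true → 𝟘 ≤e g k) → 𝟘 ≤e sumOver P g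
  sumOver-nonneg P g nn = sum-nonneg termwise
    where
    termwise : ∀ k → 𝟘 ≤e ifE (P k) (g k)
    termwise k with P k in Pk
    ... | true  = nn k Pk
    ... | false = ≤e-refl

  sumOver-remove : ∀ {n} (P : Fin n → Bool) (g : Fin n → E) i → P i ≡ true →
                   sumOver P g ≡ g i ⊕ sumOver (P [ i ]≔ false) g
  sumOver-remove P g i Pi =
    trans (sum-cong split) (trans (sum-⊕ (pointAt i (g i)) _) (cong (_⊕ sumOver (P [ i ]≔ false) g) (sum-pointAt i (g i))))
    where
    split : ∀ k → ifE (P k) (g k) ≡ pointAt i (g i) k ⊕ ifE ((P [ i ]≔ false) k) (g k)
    split k with k ≟ i
    ... | yes refl rewrite Pi = sym (⊕-identityʳ _)
    ... | no _ = sym (⊕-identityˡ _)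

  sumOver-insert : ∀ {n} (P : Fin n → Bool) (g : Fin n → E) i → P i ≡ false →
                   sumOver (P [ i ]≔ true) g ≡ g i ⊕ sumOver P g
  sumOver-insert P g i Pi =
    trans (sumOver-remove (P [ i ]≔ true) g i (≔-same P i true))
          (cong (g i ⊕_) (sumOver-cong g (λ k → trans (≔-overwrite P i true false k) (≔-restore P i false Pi k))))

  _<ᵇ_ : ∀ {n} → Fin n → Fin n → Bool
  a <ᵇ b = ⌊ toℕ a ℕ.<? toℕ b ⌋

  <ᵇ-true : ∀ {n} {a b : Fin n} → a Fin.< b → a <ᵇ b ≡ true
  <ᵇ-true {a = a} {b} a<b = trans (isYes≗does (toℕ a ℕ.<? toℕ b)) (dec-true (toℕ a ℕ.<? toℕ b) a<b)

  <ᵇ-false : ∀ {n} {a b : Fin n} → ¬ (a Fin.< b) → a <ᵇ b ≡ false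
  <ᵇ-false {a = a} {b} a≮b = trans (isYes≗does (toℕ a ℕ.<? toℕ b)) (dec-false (toℕ a ℕ.<? toℕ b) a≮b)

  SymmetricOffDiag : ∀ {n} → (Fin n → Fin n → E) → Set
  SymmetricOffDiag {n} K = ∀ (a b : Fin n) → ¬ (a ≡ b) → K a b ≡ K b a

  NonnegOffDiag : ∀ {n} → (Fin n → Fin n → E) → Set
  NonnegOffDiag {n} K = ∀ (a b : Fin n) → ¬ (a ≡ b) → 𝟘 ≤e K a b

  -- The ultrametric-type inequality of the paper: K x z ≥ min (K x y) (K y z) for
  -- distinct x, y, z, stated without min.
  UltraOffDiag : ∀ {n} → (Fin n → Fin n → E) → Set
  UltraOffDiag {n} K = ∀ (x y z : Fin n) → ¬ (x ≡ y) → ¬ (y ≡ z) → ¬ (x ≡ z) →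
                       K x y ≤e K x z ⊎ K y z ≤e K x z

  module QuadraticForm {n} (h : Fin n → R) (K : Fin n → Fin n → E) where

    f : (Fin n → Bool) → E
    f = quadFun ℝ h K

    pairTerm : (Fin n → Bool) → Fin n → Fin n → E
    pairTerm x a b = ifE (x a ∧ x b ∧ a <ᵇ b) (K a b)

    row : (Fin n → Bool) → Fin n → E
    row x a = sum (pairTerm x a)

    f-cong : ∀ {x y} → (∀ k → x k ≡ y k) → f x ≡ f y
    f-cong eq = cong₂ _⊕_ (sumOver-cong (λ k → fin (h k)) eq)
      (sum-cong λ a → sum-cong λ b → cong₂ (λ p q → ifE (p ∧ q) (K a b)) (eq a) (cong (_∧ _) (eq b)))

    module Insert (K-sym : SymmetricOffDiag K) (x : Fin n → Bool) (i : Fin n) (xi : x i ≡ false) where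

      x′ : Fin n → Bool
      x′ = x [ i ]≔ true

      later : E
      later = sum (λ b → ifE (x b ∧ i <ᵇ b) (K i b))

      earlier : Fin n → E
      earlier a = ifE (x a ∧ a <ᵇ i) (K a i)

      row-i : row x′ i ≡ later
      row-i = sum-cong termwise
        where
        termwise : ∀ b → pairTerm x′ i b ≡ ifE (x b ∧ i <ᵇ b) (K i b)
        termwise b rewrite ≔-same x i true with b ≟ i
        ... | yes refl rewrite <ᵇ-false {a = b} (Finₚ.<-irrefl refl) | Boolₚ.∧-zeroʳ (x b) = refl
        ... | no _ = refl

      row-i-before : row x i ≡ 𝟘
      row-i-before = sum-zero (λ b → cong (λ c → ifE (c ∧ x b ∧ i <ᵇ b) (K i b)) xi)

      row-other : ∀ a → ¬ (a ≡ i) → row x′ a ≡ row x a ⊕ earlier a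
      row-other a a≢i = trans (sum-cong termwise)
        (trans (sum-⊕ (pairTerm x a) (pointAt i (earlier a))) (cong (row x a ⊕_) (sum-pointAt i (earlier a))))
        where
        termwise : ∀ b → pairTerm x′ a b ≡ pairTerm x a b ⊕ pointAt i (earlier a) b
        termwise b rewrite ≔-other x i true a a≢i with b ≟ i
        ... | yes refl rewrite xi | Boolₚ.∧-zeroʳ (x a) = sym (⊕-identityˡ _)
        ... | no _ = sym (⊕-identityʳ _)

      row-insert : ∀ a → row x′ a ≡ row x a ⊕ (pointAt i later a ⊕ earlier a)
      row-insert a = by-cases (a ≟ i)
        where
        by-cases : Dec (a ≡ i) → row x′ a ≡ row x a ⊕ (pointAt i later a ⊕ earlier a)
        by-cases (yes refl) =
          sym (trans (cong₂ _⊕_ row-i-before (cong₂ _⊕_ (pointAt-same i later) earlier-i))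
                     (trans (⊕-identityˡ _) (trans (⊕-identityʳ later) (sym row-i))))
          where
          earlier-i : earlier i ≡ 𝟘
          earlier-i = cong (λ c → ifE (c ∧ i <ᵇ i) (K i i)) xi
        by-cases (no a≢i) =
          trans (row-other a a≢i)
                (cong (row x a ⊕_) (sym (trans (cong (_⊕ earlier a) (pointAt-other i later a a≢i)) (⊕-identityˡ _))))

      split-by-order : ∀ k → ifE (x k) (K i k) ≡ ifE (x k ∧ i <ᵇ k) (K i k) ⊕ earlier k
      split-by-order k with Finₚ.<-cmp k i
      ... | tri< k<i _ _ rewrite <ᵇ-true k<i | <ᵇ-false (Finₚ.<-asym k<i) with x k
      ...   | true  = trans (K-sym i k (λ i≡k → Finₚ.<-irrefl (sym i≡k) k<i)) (sym (⊕-identityˡ _))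
      ...   | false = sym (⊕-identityˡ _)
      split-by-order k | tri≈ _ refl _ rewrite xi = sym (⊕-identityˡ _)
      split-by-order k | tri> _ _ i<k rewrite <ᵇ-true i<k | <ᵇ-false (Finₚ.<-asym i<k) with x k
      ...   | true  = sym (⊕-identityʳ _)
      ...   | false = sym (⊕-identityˡ _)

      new-pairs : later ⊕ sum earlier ≡ sumOver x (K i)
      new-pairs = trans (sym (sum-⊕ (λ b → ifE (x b ∧ i <ᵇ b) (K i b)) earlier)) (sym (sum-cong split-by-order))

      pairs-insert : sum (row x′) ≡ sum (row x) ⊕ sumOver x (K i)
      pairs-insert = trans (sum-cong row-insert)
        (trans (sum-⊕ (row x) (λ a → pointAt i later a ⊕ earlier a))
        (cong (sum (row x) ⊕_)
          (trans (sum-⊕ (pointAt i later) earlier) (trans (cong (_⊕ sum earlier) (sum-pointAt i later)) new-pairs))))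

      f-insert : f x′ ≡ f x ⊕ (fin (h i) ⊕ sumOver x (K i))
      f-insert = trans (cong₂ _⊕_ (sumOver-insert x (λ k → fin (h k)) i xi) pairs-insert)
        (solve 4 (λ a b c d → (a ⊞ b) ⊞ (c ⊞ d) ⊜ (b ⊞ c) ⊞ (a ⊞ d)) refl
               (fin (h i)) (sumOver x (λ k → fin (h k))) (sum (row x)) (sumOver x (K i)))

    open Insert public using (f-insert)

    f-remove : SymmetricOffDiag K → ∀ x i → x i ≡ true →
               f x ≡ f (x [ i ]≔ false) ⊕ (fin (h i) ⊕ sumOver (x [ i ]≔ false) (K i))
    f-remove K-sym x i xi =
      trans (f-cong (λ k → sym (trans (≔-overwrite x i false true k) (≔-restore x i true xi k))))
            (f-insert K-sym (x [ i ]≔ false) i (≔-same x i false))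

  member? : ∀ {n} (A : Fin n → Bool) → Decidable (λ k → A k ≡ true)
  member? A k = A k Bool.≟ true

  nonempty-or-empty : ∀ {n} (A : Fin n → Bool) → (∃ λ k → A k ≡ true) ⊎ (∀ k → A k ≡ false)
  nonempty-or-empty A with Finₚ.any? (member? A)
  ... | yes nonempty = inj₁ nonempty
  ... | no  none     = inj₂ (λ k → Boolₚ.¬-not (λ Ak → none (k , Ak)))

  false≢true : ¬ (false ≡ true)
  false≢true ()

  common-or-disjoint : ∀ {n} (A B : Fin n → Bool) →
                       (∃ λ k → A k ≡ true × B k ≡ true) ⊎ (∀ k → B k ≡ true → A k ≡ false)
  common-or-disjoint A B with Finₚ.any? (λ k → member? A k ×-dec member? B k)
  ... | yes common = inj₁ common
  ... | no  none   = inj₂ (λ k Bk → Boolₚ.¬-not (λ Ak → none (k , Ak , Bk)))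

  count : ∀ {n} → (Fin n → Bool) → ℕ
  count {zero}  A = 0
  count {suc n} A = (if A Fin.zero then 1 else 0) + count (A ∘ Fin.suc)

  count-cong : ∀ {n} {A B : Fin n → Bool} → (∀ k → A k ≡ B k) → count A ≡ count B
  count-cong {zero}  eq = refl
  count-cong {suc n} eq = cong₂ _+_ (cong (λ b → if b then 1 else 0) (eq Fin.zero)) (count-cong (eq ∘ Fin.suc))

  count-remove : ∀ {n} (A : Fin n → Bool) u → A u ≡ true → count A ≡ suc (count (A [ u ]≔ false))
  count-remove {suc n} A Fin.zero Au rewrite Au = refl
  count-remove {suc n} A (Fin.suc u) Au =
    trans (cong ((if A Fin.zero then 1 else 0) +_) (count-remove (A ∘ Fin.suc) u Au))
          (trans (ℕₚ.+-suc _ _) (cong suc (cong₂ _+_ refl (count-cong shift))))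
    where
    shift : ∀ k → ((A ∘ Fin.suc) [ u ]≔ false) k ≡ (A [ Fin.suc u ]≔ false) (Fin.suc k)
    shift k = by-cases (k ≟ u)
      where
      by-cases : Dec (k ≡ u) → ((A ∘ Fin.suc) [ u ]≔ false) k ≡ (A [ Fin.suc u ]≔ false) (Fin.suc k)
      by-cases (yes refl) = trans (≔-same (A ∘ Fin.suc) k false) (sym (≔-same A (Fin.suc k) false))
      by-cases (no k≢u) = trans (≔-other (A ∘ Fin.suc) u false k k≢u)
                                (sym (≔-other A (Fin.suc u) false (Fin.suc k) (k≢u ∘ Finₚ.suc-injective)))

  open Extremum (TotalOrder.totalPreorder ≤e-totalOrder) using (argmax)

  -- The exchange axiom
  -- for quadFun h K at x, y and i reduces (after cancelling the linear terms and the
  -- pairs not involving the moved elements) to the following statement about the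
  -- subsets A = x − χᵢ and B = y, which we prove by induction on |A|.
  module RowExchange {n} (K : Fin n → Fin n → E) (K-sym : SymmetricOffDiag K)
                     (K-nonneg : NonnegOffDiag K) (K-ultra : UltraOffDiag K) (i : Fin n) where

    Exchange : (Fin n → Bool) → (Fin n → Bool) → Set
    Exchange A B =
      sumOver B (K i) ≤e sumOver A (K i)
      ⊎ Σ (Fin n) λ j → B j ≡ true × A j ≡ false ×
          (sumOver A (K j) ⊕ sumOver (B [ j ]≔ false) (K i) ≤e sumOver A (K i) ⊕ sumOver (B [ j ]≔ false) (K j))

    exchange-match : ∀ A B u v → A u ≡ true → B v ≡ true → K i v ≤e K i u →
      (∀ j → B j ≡ true → A j ≡ false → ¬ (j ≡ v) → K j u ⊕ K i v ≤e K i u ⊕ K j v) →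
      (∀ j → B j ≡ true → ¬ (j ≡ v) → ¬ (j ≡ u)) →
      Exchange (A [ u ]≔ false) (B [ v ]≔ false) → Exchange A B
    exchange-match A B u v Au Bv iv≤iu _ _ (inj₁ smaller) =
      inj₁ (subst₂ _≤e_ (sym (sumOver-remove B (K i) v Bv)) (sym (sumOver-remove A (K i) u Au))
                        (⊕-mono iv≤iu smaller))
    exchange-match A B u v Au Bv iv≤iu pair-ok B-avoids-u (inj₂ (j , B′j , A′j , ineq)) =
      inj₂ (j , Bj , Aj , subst₂ _≤e_ (regroup (K j) (K i)) (regroup (K i) (K j))
                                      (⊕-mono (pair-ok j Bj Aj j≢v) ineq))
      where
      j≢v : ¬ (j ≡ v)
      j≢v refl = false≢true (trans (sym (≔-same B j false)) B′j)
      Bj : B j ≡ true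
      Bj = trans (sym (≔-other B v false j j≢v)) B′j
      Aj : A j ≡ false
      Aj = trans (sym (≔-other A u false j (B-avoids-u j Bj j≢v))) A′j
      regroup : ∀ g g′ → (g u ⊕ g′ v) ⊕
                           (sumOver (A [ u ]≔ false) g ⊕ sumOver (B [ v ]≔ false [ j ]≔ false) g′)
                         ≡ sumOver A g ⊕ sumOver (B [ j ]≔ false) g′
      regroup g g′ = sym (trans (cong₂ _⊕_ (sumOver-remove A g u Au) removeV) (interchange _ _ _ _))
        where
        removeV : sumOver (B [ j ]≔ false) g′ ≡ g′ v ⊕ sumOver (B [ v ]≔ false [ j ]≔ false) g′
        removeV = trans (sumOver-remove (B [ j ]≔ false) g′ v (trans (≔-other B j false v (j≢v ∘ sym)) Bv))
                        (cong (g′ v ⊕_) (sumOver-cong g′ (≔-comm B false false j≢v)))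

    exchange-termwise : ∀ A B j → B j ≡ true → A j ≡ false →
      (∀ k → A k ≡ true → K j k ≤e K i k) → (∀ k → B k ≡ true → ¬ (k ≡ j) → K i k ≤e K j k) →
      Exchange A B
    exchange-termwise A B j Bj Aj onA onB =
      inj₂ (j , Bj , Aj , ⊕-mono (sumOver-mono A onA) (sumOver-mono (B [ j ]≔ false) onB′))
      where
      onB′ : ∀ k → (B [ j ]≔ false) k ≡ true → K i k ≤e K j k
      onB′ k B′k with k ≟ j
      ... | yes _ = ⊥-elim (false≢true B′k)
      ... | no k≢j = onB k B′k k≢j

    removal-keeps-i : ∀ (A : Fin n → Bool) u → A i ≡ false → (A [ u ]≔ false) i ≡ false
    removal-keeps-i A u Ai with i ≟ u
    ... | yes _ = refl
    ... | no _ = Ai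

    Smaller : (Fin n → Bool) → Set
    Smaller A = ∀ {A′} → count A′ ℕ.< count A →
                ∀ B′ → A′ i ≡ false → B′ i ≡ false → Exchange A′ B′

    shrink : ∀ (A : Fin n → Bool) u → A u ≡ true → count (A [ u ]≔ false) ℕ.< count A
    shrink A u Au = ℕₚ.≤-reflexive (sym (count-remove A u Au))

    -- A common element of A and B cancels.
    exchange-common : ∀ A B w → A w ≡ true → B w ≡ true → A i ≡ false → B i ≡ false →
                      Smaller A → Exchange A B
    exchange-common A B w Aw Bw Ai Bi IH =
      exchange-match A B w w Aw Bw ≤e-refl (λ _ _ _ _ → ≤e-reflexive (⊕-comm _ _)) (λ _ _ j≢w → j≢w)
        (IH (shrink A w Aw) (B [ w ]≔ false) (removal-keeps-i A w Ai) (removal-keeps-i B w Bi))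

    not-member : ∀ (A : Fin n → Bool) → A i ≡ false → ∀ {k} → A k ≡ true → ¬ (i ≡ k)
    not-member A Ai Ak refl = false≢true (trans (sym Ai) Ak)

    exchange-empty : ∀ A B → A i ≡ false → (∀ k → B k ≡ false) → Exchange A B
    exchange-empty A B Ai B-empty =
      inj₁ (subst (_≤e sumOver A (K i)) (sym (sumOver-empty (K i) B-empty))
                  (sumOver-nonneg A (K i) (λ k Ak → K-nonneg i k (not-member A Ai Ak))))

    module Disjoint (A B : Fin n → Bool) (Ai : A i ≡ false) (Bi : B i ≡ false)
                    (disjoint : ∀ k → B k ≡ true → A k ≡ false)
                    (v : Fin n) (Bv : B v ≡ true) (v-max : ∀ k → B k ≡ true → K i k ≤e K i v) where

      i∉A : ∀ {k} → A k ≡ true → ¬ (i ≡ k)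
      i∉A = not-member A Ai

      i∉B : ∀ {k} → B k ≡ true → ¬ (i ≡ k)
      i∉B = not-member B Bi

      A≠B : ∀ {a b} → A a ≡ true → B b ≡ true → ¬ (a ≡ b)
      A≠B Aa Bb refl = false≢true (trans (sym (disjoint _ Bb)) Aa)

      -- If v is no closer to A than i is to v, exchanging i with v works termwise.
      exchange-at-max : (∀ k → A k ≡ true → K v k ≤e K i v) → Exchange A B
      exchange-at-max bound = exchange-termwise A B v Bv (disjoint v Bv) onA onB
        where
        onA : ∀ k → A k ≡ true → K v k ≤e K i k
        onA k Ak with K-ultra i v k (i∉B Bv) (λ v≡k → A≠B Ak Bv (sym v≡k)) (i∉A Ak)
        ... | inj₁ iv≤ik = ≤e-trans (bound k Ak) iv≤ik
        ... | inj₂ vk≤ik = vk≤ik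
        onB : ∀ k → B k ≡ true → ¬ (k ≡ v) → K i k ≤e K v k
        onB k Bk k≢v with K-ultra v i k (i∉B Bv ∘ sym) (i∉B Bk) (k≢v ∘ sym)
        ... | inj₁ vi≤vk = ≤e-trans (v-max k Bk) (≤e-trans (≤e-reflexive (K-sym i v (i∉B Bv))) vi≤vk)
        ... | inj₂ ik≤vk = ik≤vk

      -- Otherwise some u ∈ A with K v u ≥ K i v is matched with the v′ ∈ B maximising K u.
      exchange-matched : ∀ u → A u ≡ true → K i v ≤e K v u → Smaller A → Exchange A B
      exchange-matched u Au iv≤vu IH with argmax (member? B) (K u) (v , Bv)
      ... | v′ , Bv′ , v′-max =
        exchange-match A B u v′ Au Bv′ iv′≤iu pair-ok (λ j Bj _ j≡u → A≠B Au Bj (sym j≡u))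
          (IH (shrink A u Au) (B [ v′ ]≔ false) (removal-keeps-i A u Ai) (removal-keeps-i B v′ Bi))
        where
        iv≤iu : K i v ≤e K i u
        iv≤iu with K-ultra i v u (i∉B Bv) (λ v≡u → A≠B Au Bv (sym v≡u)) (i∉A Au)
        ... | inj₁ le = le
        ... | inj₂ vu≤iu = ≤e-trans iv≤vu vu≤iu
        iv′≤iu : K i v′ ≤e K i u
        iv′≤iu = ≤e-trans (v-max v′ Bv′) iv≤iu
        pair-ok : ∀ j → B j ≡ true → A j ≡ false → ¬ (j ≡ v′) → K j u ⊕ K i v′ ≤e K i u ⊕ K j v′
        pair-ok j Bj _ j≢v′ = subst (K j u ⊕ K i v′ ≤e_) (⊕-comm _ _) (⊕-mono ju≤jv′ iv′≤iu)
          where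
          j≢u : ¬ (j ≡ u)
          j≢u j≡u = A≠B Au Bj (sym j≡u)
          ju≤jv′ : K j u ≤e K j v′
          ju≤jv′ with K-ultra j u v′ j≢u (A≠B Au Bv′) j≢v′
          ... | inj₁ le = le
          ... | inj₂ uv′≤jv′ = ≤e-trans (≤e-trans (≤e-reflexive (K-sym j u j≢u)) (v′-max j Bj)) uv′≤jv′

      exchange-disjoint : Smaller A → Exchange A B
      exchange-disjoint IH with nonempty-or-empty A
      ... | inj₂ A-empty = exchange-at-max (λ k Ak → ⊥-elim (false≢true (trans (sym (A-empty k)) Ak)))
      ... | inj₁ A-nonempty with argmax (member? A) (K v) A-nonempty
      ...   | u , Au , u-max with ≤e-total (K v u) (K i v)
      ...     | inj₁ vu≤iv = exchange-at-max (λ k Ak → ≤e-trans (u-max k Ak) vu≤iv)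
      ...     | inj₂ iv≤vu = exchange-matched u Au iv≤vu IH

    exchange : ∀ A B → A i ≡ false → B i ≡ false → Exchange A B
    exchange A = All.wfRec (On.wellFounded count <-wellFounded) _ Goal step A
      where
      Goal : (Fin n → Bool) → Set
      Goal A = ∀ B → A i ≡ false → B i ≡ false → Exchange A B
      step : ∀ A → (∀ {A′} → count A′ ℕ.< count A → Goal A′) → Goal A
      step A IH B Ai Bi with common-or-disjoint A B
      ... | inj₁ (w , Aw , Bw) = exchange-common A B w Aw Bw Ai Bi IH
      ... | inj₂ disjoint with nonempty-or-empty B
      ...   | inj₂ B-empty = exchange-empty A B Ai B-empty
      ...   | inj₁ B-nonempty with argmax (member? B) (K i) B-nonempty
      ...     | v , Bv , v-max = Disjoint.exchange-disjoint A B Ai Bi disjoint v Bv v-max IH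

  -- The two alternatives of the exchange lemma give the two alternatives of the
  -- exchange axiom for f = quadFun h K at x, y and i ∈ x − y: adding back the terms
  -- cancelled there turns either inequality into the required one.
  module ExchangeAxiom {n} (h : Fin n → R) (K : Fin n → Fin n → E) (K-sym : SymmetricOffDiag K)
                       (x y : Fin n → Bool) (i : Fin n) (xi : x i ≡ true) (yi : y i ≡ false) where
    open QuadraticForm h K using (f; f-cong; f-insert; f-remove)

    x₀ : Fin n → Bool
    x₀ = x [ i ]≔ false

    move : sumOver y (K i) ≤e sumOver x₀ (K i) → f x₀ ⊕ f (y [ i ]≔ true) ≤e f x ⊕ f y
    move smaller = subst₂ _≤e_ (sym lhs) (sym rhs) (⊕-monoʳ (f x₀ ⊕ f y) (⊕-monoʳ (fin (h i)) smaller))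
      where
      lhs : f x₀ ⊕ f (y [ i ]≔ true) ≡ (f x₀ ⊕ f y) ⊕ (fin (h i) ⊕ sumOver y (K i))
      lhs = trans (cong (f x₀ ⊕_) (f-insert K-sym y i yi)) (sym (⊕-assoc _ _ _))
      rhs : f x ⊕ f y ≡ (f x₀ ⊕ f y) ⊕ (fin (h i) ⊕ sumOver x₀ (K i))
      rhs = trans (cong (_⊕ f y) (f-remove K-sym x i xi))
                  (solve 3 (λ a b c → (a ⊞ c) ⊞ b ⊜ (a ⊞ b) ⊞ c) refl (f x₀) (f y) _)

    swap : ∀ j → y j ≡ true → x₀ j ≡ false →
           sumOver x₀ (K j) ⊕ sumOver (y [ j ]≔ false) (K i) ≤e sumOver x₀ (K i) ⊕ sumOver (y [ j ]≔ false) (K j) →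
           f (x₀ [ j ]≔ true) ⊕ f (y [ i ]≔ true [ j ]≔ false) ≤e f x ⊕ f y
    swap j yj x₀j smaller =
      subst₂ _≤e_ (sym lhs) (sym rhs) (⊕-monoʳ (f x₀ ⊕ f y₀) (⊕-monoʳ (fin (h j) ⊕ fin (h i)) smaller))
      where
      y₀ : Fin n → Bool
      y₀ = y [ j ]≔ false
      j≢i : ¬ (j ≡ i)
      j≢i refl = false≢true (trans (sym yi) yj)
      y₀i : y₀ i ≡ false
      y₀i = trans (≔-other y j false i (j≢i ∘ sym)) yi
      regroup : ∀ a b c d e g → (a ⊕ (b ⊕ c)) ⊕ (d ⊕ (e ⊕ g)) ≡ (a ⊕ d) ⊕ ((b ⊕ e) ⊕ (c ⊕ g))
      regroup = solve 6 (λ a b c d e g → (a ⊞ (b ⊞ c)) ⊞ (d ⊞ (e ⊞ g)) ⊜ (a ⊞ d) ⊞ ((b ⊞ e) ⊞ (c ⊞ g)))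
                        refl
      lhs : f (x₀ [ j ]≔ true) ⊕ f (y [ i ]≔ true [ j ]≔ false)
            ≡ (f x₀ ⊕ f y₀) ⊕ ((fin (h j) ⊕ fin (h i)) ⊕ (sumOver x₀ (K j) ⊕ sumOver y₀ (K i)))
      lhs = trans (cong₂ _⊕_ (f-insert K-sym x₀ j x₀j)
                             (trans (f-cong (≔-comm y true false (j≢i ∘ sym))) (f-insert K-sym y₀ i y₀i)))
                  (regroup _ _ _ _ _ _)
      rhs : f x ⊕ f y ≡ (f x₀ ⊕ f y₀) ⊕ ((fin (h j) ⊕ fin (h i)) ⊕ (sumOver x₀ (K i) ⊕ sumOver y₀ (K j)))
      rhs = trans (cong₂ _⊕_ (f-remove K-sym x i xi) (f-remove K-sym y j yj))
                  (trans (regroup _ _ _ _ _ _)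
                         (cong (λ s → (f x₀ ⊕ f y₀) ⊕ (s ⊕ (sumOver x₀ (K i) ⊕ sumOver y₀ (K j)))) (⊕-comm _ _)))

  ultra⇒M♮-convex : ∀ {n} (h : Fin n → R) (K : Fin n → Fin n → E) →
    SymmetricOffDiag K → NonnegOffDiag K → UltraOffDiag K → IsMnatConvex ℝ (quadFun ℝ h K)
  ultra⇒M♮-convex h K K-sym K-nonneg K-ultra x y i xi yi
    with RowExchange.exchange K K-sym K-nonneg K-ultra i (x [ i ]≔ false) y (≔-same x i false) yi
  ... | inj₁ smaller = inj₁ (ExchangeAxiom.move h K K-sym x y i xi yi smaller)
  ... | inj₂ (j , yj , x₀j , smaller) =
    inj₂ (j , yj , xj , ExchangeAxiom.swap h K K-sym x y i xi yi j yj x₀j smaller)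
    where
    xj : x j ≡ false
    xj = trans (sym (≔-other x i false j (λ { refl → false≢true (trans (sym yi) yj) }))) x₀j

  ∅ : ∀ {n} → Fin n → Bool
  ∅ _ = false

  singleton : ∀ {n} → Fin n → Fin n → Bool
  singleton a = ∅ [ a ]≔ true

  pair : ∀ {n} → Fin n → Fin n → Fin n → Bool
  pair a b = singleton a [ b ]≔ true

  singleton-other : ∀ {n} (a k : Fin n) → ¬ (k ≡ a) → singleton a k ≡ false
  singleton-other a k = ≔-other ∅ a true k

  singleton-member : ∀ {n} (a k : Fin n) → singleton a k ≡ true → k ≡ a
  singleton-member a k member with k ≟ a
  ... | yes k≡a = k≡a
  ... | no  _ with () ← member

  pair-remove : ∀ {n} {a b : Fin n} → ¬ (a ≡ b) → ∀ k → (pair a b [ a ]≔ false) k ≡ singleton b k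
  pair-remove {a = a} {b} a≢b k = by-cases (k ≟ a) (k ≟ b)
    where
    by-cases : Dec (k ≡ a) → Dec (k ≡ b) → (pair a b [ a ]≔ false) k ≡ singleton b k
    by-cases (yes refl) _ = trans (≔-same (pair k b) k false) (sym (singleton-other b k a≢b))
    by-cases (no k≢a) (yes refl) =
      trans (≔-other (pair a k) a false k k≢a) (trans (≔-same (singleton a) k true) (sym (≔-same ∅ k true)))
    by-cases (no k≢a) (no k≢b) =
      trans (≔-other (pair a b) a false k k≢a)
            (trans (≔-other (singleton a) b true k k≢b)
                   (trans (singleton-other a k k≢a) (sym (singleton-other b k k≢b))))

  pair-swap : ∀ {n} {a b c : Fin n} → ¬ (a ≡ b) → ∀ k → (pair a b [ a ]≔ false [ c ]≔ true) k ≡ pair b c k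
  pair-swap {a = a} {b} {c} a≢b k = by-cases (k ≟ c)
    where
    by-cases : Dec (k ≡ c) → (pair a b [ a ]≔ false [ c ]≔ true) k ≡ pair b c k
    by-cases (yes refl) = trans (≔-same (pair a b [ a ]≔ false) k true) (sym (≔-same (singleton b) k true))
    by-cases (no k≢c) =
      trans (≔-other (pair a b [ a ]≔ false) c true k k≢c)
            (trans (pair-remove a≢b k) (sym (≔-other (singleton b) c true k k≢c)))

  module SmallValues {n} (h : Fin n → R) (K : Fin n → Fin n → E) (K-sym : SymmetricOffDiag K) where
    open QuadraticForm h K using (f; f-cong; f-insert; row; pairTerm)

    f-∅ : f ∅ ≡ 𝟘
    f-∅ = trans (cong₂ _⊕_ (sumOver-empty (λ k → fin (h k)) (λ _ → refl))
                           (sum-zero {g = row ∅} (λ a → sum-zero {g = pairTerm ∅ a} (λ _ → refl))))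
                (⊕-identityˡ 𝟘)

    f-single : ∀ a → f (singleton a) ≡ fin (h a)
    f-single a = trans (f-insert K-sym ∅ a refl)
      (trans (cong₂ _⊕_ f-∅ (cong (fin (h a) ⊕_) (sumOver-empty (K a) (λ _ → refl))))
             (trans (⊕-identityˡ _) (⊕-identityʳ _)))

    f-pair : ∀ a b → ¬ (a ≡ b) → f (pair a b) ≡ fin (h a) ⊕ (fin (h b) ⊕ K b a)
    f-pair a b a≢b = trans (f-insert K-sym (singleton a) b (singleton-other a b (a≢b ∘ sym)))
      (cong₂ _⊕_ (f-single a) (cong (fin (h b) ⊕_)
        (trans (sumOver-remove (singleton a) (K b) a (≔-same ∅ a true))
               (trans (cong (K b a ⊕_) (sumOver-empty (K b) emptied)) (⊕-identityʳ _)))))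
      where
      emptied : ∀ k → (singleton a [ a ]≔ false) k ≡ false
      emptied k = trans (≔-overwrite ∅ a true false k) (≔-restore ∅ a false refl k)

  -- Conversely, M♮-convexity forces the ultrametric inequality at distinct a, b, c:
  -- the exchange axiom for x = {a, c}, y = {b} and the element a has two possible
  -- outcomes, and after cancelling h a + h b + h c they read K a b ≤ K a c and
  -- K b c ≤ K a c respectively.
  module ExchangeOnPairs {n} (h : Fin n → R) (K : Fin n → Fin n → E) (K-sym : SymmetricOffDiag K)
                         {a b c : Fin n} (a≢b : ¬ (a ≡ b)) (b≢c : ¬ (b ≡ c)) (a≢c : ¬ (a ≡ c)) where
    open QuadraticForm h K using (f; f-cong)
    open SmallValues h K K-sym

    total : E
    total = fin (h a) ⊕ (fin (h b) ⊕ fin (h c))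

    before : f (pair a c) ⊕ f (singleton b) ≡ K a c ⊕ total
    before = trans (cong₂ _⊕_ (f-pair a c a≢c) (f-single b))
      (trans (cong (λ k → (fin (h a) ⊕ (fin (h c) ⊕ k)) ⊕ fin (h b)) (K-sym c a (a≢c ∘ sym)))
             (solve 4 (λ ha hb hc k → (ha ⊞ (hc ⊞ k)) ⊞ hb ⊜ k ⊞ (ha ⊞ (hb ⊞ hc))) refl _ _ _ _))

    after-move : f (pair a c [ a ]≔ false) ⊕ f (pair b a) ≡ K a b ⊕ total
    after-move = trans (cong₂ _⊕_ (trans (f-cong (pair-remove a≢c)) (f-single c)) (f-pair b a (a≢b ∘ sym)))
                       (solve 4 (λ ha hb hc k → hc ⊞ (hb ⊞ (ha ⊞ k)) ⊜ k ⊞ (ha ⊞ (hb ⊞ hc))) refl _ _ _ _)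

    after-swap : f (pair a c [ a ]≔ false [ b ]≔ true) ⊕ f (pair b a [ b ]≔ false) ≡ K b c ⊕ total
    after-swap = trans (cong₂ _⊕_ (trans (f-cong (pair-swap a≢c)) (f-pair c b (b≢c ∘ sym)))
                                  (trans (f-cong (pair-remove (a≢b ∘ sym))) (f-single a)))
                       (solve 4 (λ ha hb hc k → (hc ⊞ (hb ⊞ k)) ⊞ ha ⊜ k ⊞ (ha ⊞ (hb ⊞ hc))) refl _ _ _ _)

  M♮-convex⇒ultra : ∀ {n} (h : Fin n → R) (K : Fin n → Fin n → E) →
    SymmetricOffDiag K → IsMnatConvex ℝ (quadFun ℝ h K) → UltraOffDiag K
  M♮-convex⇒ultra h K K-sym convex a b c a≢b b≢c a≢c
    with convex (pair a c) (singleton b) a (trans (≔-other (singleton a) c true a a≢c) (≔-same ∅ a true))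
                (singleton-other b a a≢b)
  ... | inj₁ ineq = inj₁ (⊕-cancelʳ _ (subst₂ _≤e_ after-move before ineq))
    where open ExchangeOnPairs h K K-sym a≢b b≢c a≢c
  ... | inj₂ (j , bj , _ , ineq) with singleton-member b j bj
  ...   | refl = inj₂ (⊕-cancelʳ _ (subst₂ _≤e_ after-swap before ineq))
    where open ExchangeOnPairs h K K-sym a≢b b≢c a≢c

  module Cyclic (m : ℕ) where
    N : ℕ
    N = suc m

    toℕ-mod : ∀ x → toℕ (x mod N) ≡ x % N
    toℕ-mod x = Finₚ.toℕ-fromℕ< (m%n<n x N)

    toℕ-next : ∀ (a : Fin N) → toℕ (next ℝ a) ≡ suc (toℕ a) % N
    toℕ-next a = toℕ-mod (suc (toℕ a))

    next-inner : ∀ (a : Fin N) → toℕ a < m → toℕ (next ℝ a) ≡ suc (toℕ a)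
    next-inner a a<m = trans (toℕ-next a) (m<n⇒m%n≡m (s≤s a<m))

    next-last : ∀ (a : Fin N) → toℕ a ≡ m → toℕ (next ℝ a) ≡ 0
    next-last a a≡m = trans (toℕ-next a) (trans (cong (λ z → suc z % N) a≡m) (n%n≡0 N))

    next-mod : ∀ x → next ℝ (x mod N) ≡ suc x mod N
    next-mod x = Finₚ.toℕ-injective (trans (toℕ-next (x mod N))
      (trans (cong (λ z → suc z % N) (toℕ-mod x)) (trans suc-% (sym (toℕ-mod (suc x))))))
      where
      suc-% : suc (x % N) % N ≡ suc x % N
      suc-% = trans (%-distribˡ-+ 1 (x % N) N)
                (trans (cong (λ z → (1 % N + z) % N) (m%n%n≡m%n x N)) (sym (%-distribˡ-+ 1 x N)))

    around : ∀ (a : Fin N) → (suc (toℕ a) + m) mod N ≡ a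
    around a = Finₚ.toℕ-injective (trans (toℕ-mod (suc (toℕ a) + m))
      (trans (cong (_% N) (sym (ℕₚ.+-suc (toℕ a) m)))
             (trans ([m+n]%n≡m%n (toℕ a) N) (m<n⇒m%n≡m (Finₚ.toℕ<n a)))))

    shift-moves : ∀ (a : Fin N) d → 0 < d → d < N → ¬ ((toℕ a + d) mod N ≡ a)
    shift-moves a d 0<d d<N eq with toℕ a + d ℕ.<? N
    ... | yes small = ℕₚ.<⇒≢ (ℕₚ.m<m+n (toℕ a) 0<d)
                        (sym (trans (sym (m<n⇒m%n≡m small)) (trans (sym (toℕ-mod (toℕ a + d))) (cong toℕ eq))))
    ... | no large = ℕₚ.<⇒≢ d<N (sym (ℕₚ.+-cancelˡ-≡ (toℕ a) N d x+N≡x+d))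
      where
      x r : ℕ
      x = toℕ a
      r = (x + d) ℕ.∸ N
      r+N≡x+d : r + N ≡ x + d
      r+N≡x+d = ℕₚ.m∸n+n≡m (ℕₚ.≮⇒≥ large)
      r≡x : r ≡ x
      r≡x = trans (sym (m<n⇒m%n≡m r<N))
              (trans (sym ([m+n]%n≡m%n r N))
                     (trans (cong (_% N) r+N≡x+d) (trans (sym (toℕ-mod (toℕ a + d))) (cong toℕ eq))))
        where
        r<N : r < N
        r<N = ℕₚ.+-cancelʳ-< N r N (subst (_< N + N) (sym r+N≡x+d) (ℕₚ.+-mono-< (Finₚ.toℕ<n a) d<N))
      x+N≡x+d : x + N ≡ x + d
      x+N≡x+d = trans (cong (_+ N) (sym r≡x)) r+N≡x+d

    next-moves : 1 ≤ m → ∀ (a : Fin N) → ¬ (next ℝ a ≡ a)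
    next-moves 1≤m a eq = shift-moves a 1 (s≤s z≤n) (s≤s 1≤m) (trans (cong (_mod N) (ℕₚ.+-comm (toℕ a) 1)) eq)

  module Threshold {n} (K : Fin n → Fin n → E) (K-ultra : UltraOffDiag K) (t : E) where

    Linked : Fin n → Fin n → Set
    Linked x y = x ≡ y ⊎ t ≤e K x y

    linked-trans : ∀ {x y z} → Linked x y → Linked y z → Linked x z
    linked-trans (inj₁ refl) yz = yz
    linked-trans xy (inj₁ refl) = xy
    linked-trans {x} {y} {z} (inj₂ t≤xy) (inj₂ t≤yz) with x ≟ z | x ≟ y | y ≟ z
    ... | yes x≡z | _ | _ = inj₁ x≡z
    ... | no _ | yes refl | _ = inj₂ t≤yz
    ... | no _ | no _ | yes refl = inj₂ t≤xy
    ... | no x≢z | no x≢y | no y≢z with K-ultra x y z x≢y y≢z x≢z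
    ...   | inj₁ xy≤xz = inj₂ (≤e-trans t≤xy xy≤xz)
    ...   | inj₂ yz≤xz = inj₂ (≤e-trans t≤yz yz≤xz)

  -- Around a cycle v₀ … v_m (m ≥ 1) whose edge weights are entries of an ultrametric
  -- K, every edge weighs at least the minimum of the other edges: walk from the far
  -- end of the edge a back to its start along the remaining edges.
  edge-above-others : ∀ {n m} (K : Fin n → Fin n → E) → SymmetricOffDiag K → UltraOffDiag K → 1 ≤ m →
    (v : Fin (suc m) → Fin n) → (∀ a b → v a ≡ v b → a ≡ b) → (w : Fin (suc m) → E) →
    (∀ a → K (v a) (v (next ℝ a)) ≡ w a) →
    ∀ a t → (∀ e → ¬ (e ≡ a) → t ≤e w e) → t ≤e w a
  edge-above-others {n} {m} K K-sym K-ultra 1≤m v v-inj w weights a t others =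
    close (subst₂ Linked (cong (λ z → v (z mod N)) (ℕₚ.+-identityʳ start)) (cong v (around a))
                         (chain m ℕₚ.≤-refl))
    where
    open Cyclic m
    open Threshold K K-ultra t
    start : ℕ
    start = suc (toℕ a)
    vertexAt : ℕ → Fin n
    vertexAt c = v ((start + c) mod N)
    step : ∀ c → c < m → Linked (vertexAt c) (vertexAt (suc c))
    step c c<m = inj₂ (subst (λ z → t ≤e K (v e) (v z)) next-e (subst (t ≤e_) (sym (weights e)) (others e e≢a)))
      where
      e : Fin N
      e = (start + c) mod N
      e≢a : ¬ (e ≡ a)
      e≢a = shift-moves a (suc c) (s≤s z≤n) (s≤s c<m) ∘ trans (cong (_mod N) (ℕₚ.+-suc (toℕ a) c))
      next-e : next ℝ e ≡ (start + suc c) mod N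
      next-e = trans (next-mod (start + c)) (cong (_mod N) (sym (ℕₚ.+-suc start c)))
    chain : ∀ c → c ≤ m → Linked (vertexAt 0) (vertexAt c)
    chain zero _ = inj₁ refl
    chain (suc c) c<m = linked-trans (chain c (ℕₚ.<⇒≤ c<m)) (step c c<m)
    distinct : ¬ (v (next ℝ a) ≡ v a)
    distinct = next-moves 1≤m a ∘ v-inj (next ℝ a) a
    close : Linked (v (next ℝ a)) (v a) → t ≤e w a
    close (inj₁ eq) = ⊥-elim (distinct eq)
    close (inj₂ t≤K) = subst (t ≤e_) (trans (K-sym _ _ distinct) (weights a)) t≤K

  open Extremum (flipped (TotalOrder.totalPreorder ≤e-totalOrder)) using () renaming (argmax to argmin)

  completable⇒min-twice : ∀ {n} (H : PartialMatrix ℝ n) → Completable ℝ H →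
                          ∀ (C : ChordlessCycle ℝ H) → MinTwice ℝ C
  completable⇒min-twice H (K , K-sym , agrees , h , convex) C = a₁ , a₂ , a₂≢a₁ ∘ sym , a₁-min , a₂-min
    where
    open ChordlessCycle C
    open Cyclic m using (next-moves)
    1≤m : 1 ≤ m
    1≤m = ℕₚ.≤-pred (ℕₚ.≤-trans (s≤s (s≤s z≤n)) len≥3)
    weights : ∀ a → K (v a) (v (next ℝ a)) ≡ w a
    weights a = agrees (v a) (v (next ℝ a)) (next-moves 1≤m a ∘ sym ∘ v-inj _ _) (w a) (edge a)
    lightest : Σ (Fin (suc m)) λ a → ⊤ × (∀ c → ⊤ → w a ≤e w c)
    lightest = argmin {P = λ _ → ⊤} (λ _ → yes tt) w (Fin.zero , tt)
    a₁ : Fin (suc m)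
    a₁ = proj₁ lightest
    a₁-min : ∀ c → w a₁ ≤e w c
    a₁-min c = proj₂ (proj₂ lightest) c tt
    second : Σ (Fin (suc m)) λ a → ¬ (a ≡ a₁) × (∀ c → ¬ (c ≡ a₁) → w a ≤e w c)
    second = argmin (λ c → ¬? (c ≟ a₁)) w (next ℝ a₁ , next-moves 1≤m a₁)
    a₂ : Fin (suc m)
    a₂ = proj₁ second
    a₂≢a₁ : ¬ (a₂ ≡ a₁)
    a₂≢a₁ = proj₁ (proj₂ second)
    a₂-min : ∀ c → w a₂ ≤e w c
    a₂-min c with c ≟ a₁
    ... | yes refl = edge-above-others K K-sym (M♮-convex⇒ultra h K K-sym convex) 1≤m v v-inj w weights c (w a₂)
                       (proj₂ (proj₂ second))
    ... | no c≢a₁ = proj₂ (proj₂ second) c c≢a₁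

  -- Undefined entries are read as 𝟘;
  -- K x y is the largest t such that some walk from x to y uses only entries ≥ t,
  -- computed Floyd–Warshall style by allowing the intermediate vertices one by one.
  module MaximinClosure {n} (H : PartialMatrix ℝ n) (H-sym : SymmetricPM ℝ H) (H-nonneg : NonnegPM ℝ H) where

    entry : Maybe E → E
    entry (just v) = v
    entry nothing  = 𝟘

    defined-entry : ∀ {m x} → m ≡ just x → m ≡ just (entry m)
    defined-entry refl = refl

    W : Fin n → Fin n → E
    W i j = if does (i ≟ j) then 𝟘 else entry (H i j)

    W-sym : ∀ i j → W i j ≡ W j i
    W-sym i j with i ≟ j | j ≟ i
    ... | yes _    | yes _    = refl
    ... | yes refl | no j≢i   = ⊥-elim (j≢i refl)
    ... | no i≢j   | yes refl = ⊥-elim (i≢j refl)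
    ... | no i≢j   | no _     = cong entry (H-sym i j i≢j)

    W-nonneg : ∀ i j → 𝟘 ≤e W i j
    W-nonneg i j with i ≟ j
    ... | yes _ = ≤e-refl
    ... | no i≢j with H i j in Hij
    ...   | just v  = H-nonneg i j i≢j v Hij
    ...   | nothing = ≤e-refl

    W-defined : ∀ i j → ¬ (i ≡ j) → ∀ v → H i j ≡ just v → W i j ≡ v
    W-defined i j i≢j v Hij with i ≟ j
    ... | yes i≡j = ⊥-elim (i≢j i≡j)
    ... | no _ rewrite Hij = refl

    W-cases : ∀ i j → W i j ≡ 𝟘 ⊎ H i j ≡ just (W i j)
    W-cases i j with i ≟ j
    ... | yes _ = inj₁ refl
    ... | no _ with H i j
    ...   | just v  = inj₂ refl
    ...   | nothing = inj₁ refl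

    -- D ks i j: the maximin value over walks whose interior vertices lie in ks.
    D : List (Fin n) → Fin n → Fin n → E
    D []       i j = W i j
    D (k ∷ ks) i j = D ks i j ⊔ (D ks i k ⊓ D ks k j)

    D-sym : ∀ ks i j → D ks i j ≡ D ks j i
    D-sym []       i j = W-sym i j
    D-sym (k ∷ ks) i j rewrite D-sym ks i j | D-sym ks i k | D-sym ks k j =
      cong (D ks j i ⊔_) (⊓-comm (D ks k i) (D ks j k))

    W≤D : ∀ ks i j → W i j ≤e D ks i j
    W≤D []       i j = ≤e-refl
    W≤D (k ∷ ks) i j = ≤e-trans (W≤D ks i j) (x≤x⊔y (D ks i j) (D ks i k ⊓ D ks k j))

    D-into : ∀ k ks i → D (k ∷ ks) i k ≤e D ks i k
    D-into k ks i = ⊔-lub ≤e-refl (x⊓y≤x (D ks i k) (D ks k k))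

    D-from : ∀ k ks j → D (k ∷ ks) k j ≤e D ks k j
    D-from k ks j = ⊔-lub ≤e-refl (x⊓y≤y (D ks k k) (D ks k j))

    Above : E → Fin n → Fin n → Set
    Above t x y = t ≤e W x y

    module AboveWalks (t : E) = Walks (Above t)
    open Walks.Walk

    through-more : ∀ k ks t {i j} (w : AboveWalks.Walk t i j) →
                   AboveWalks.Interior t (_∈ ks) w → AboveWalks.Interior t (_∈ k ∷ ks) w
    through-more k ks t = AboveWalks.interior-mono t {S = _∈ ks} {S′ = _∈ k ∷ ks} there

    D-walk : ∀ ks t i j → t ≤e D ks i j →
             Σ (AboveWalks.Walk t i j) λ w → AboveWalks.Interior t (_∈ ks) w × 1 ≤ len w
    D-walk []       t i j t≤W = AboveWalks.edge-walk t t≤W , AboveWalks.edge-walk-interior t (_∈ []) t≤W , s≤s z≤n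
    D-walk (k ∷ ks) t i j t≤D with ≤-⊔-split (D ks i j) (D ks i k ⊓ D ks k j) t≤D
    ... | inj₁ t≤old =
      let (w , I , nonempty) = D-walk ks t i j t≤old
      in w , through-more k ks t w I , nonempty
    ... | inj₂ t≤via-k =
      let (w₁ , I₁ , nonempty₁) = D-walk ks t i k (≤e-trans t≤via-k (x⊓y≤x (D ks i k) (D ks k j)))
          (w₂ , I₂ , _)         = D-walk ks t k j (≤e-trans t≤via-k (x⊓y≤y (D ks i k) (D ks k j)))
      in AboveWalks.concat t w₁ w₂
         , AboveWalks.concat-interior t w₁ w₂ (_∈ k ∷ ks) (through-more k ks t w₁ I₁) (through-more k ks t w₂ I₂)
                                      (here refl)
         , ℕₚ.≤-trans nonempty₁ (ℕₚ.m≤m+n (len w₁) (len w₂))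

    walk-D : ∀ ks t i j (w : AboveWalks.Walk t i j) → AboveWalks.Interior t (_∈ ks) w → 1 ≤ len w → t ≤e D ks i j
    walk-D [] t i j w I nonempty with len w in len≡
    ... | suc zero = subst₂ (Above t) (vertex-0 w) (trans (cong (vertex w) (sym len≡)) (vertex-len w))
                            (step w 0 (subst (0 <_) (sym len≡) (s≤s z≤n)))
    ... | suc (suc _) with () ← I 1 (s≤s z≤n) (s≤s (s≤s z≤n))
    walk-D (k ∷ ks) t i j w I nonempty = by-length (len w) i j w I nonempty ℕₚ.≤-refl
      where
      -- Induction on the length: split the walk at an interior visit of k, if any.
      by-length : ∀ c i j (w : AboveWalks.Walk t i j) → AboveWalks.Interior t (_∈ k ∷ ks) w →
                  1 ≤ len w → len w ≤ c → t ≤e D (k ∷ ks) i j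
      by-length zero i j w I nonempty len≤0 = ⊥-elim (ℕₚ.n≮0 (ℕₚ.<-≤-trans nonempty len≤0))
      by-length (suc c) i j w I nonempty len≤c
        with ℕₚ.anyUpTo? (λ a → (0 ℕ.<? a) ×-dec (vertex w a ≟ k)) (len w)
      ... | no avoids-k = ≤e-trans (walk-D ks t i j w I′ nonempty) (x≤x⊔y (D ks i j) (D ks i k ⊓ D ks k j))
        where
        I′ : AboveWalks.Interior t (_∈ ks) w
        I′ a 0<a a<len with I a 0<a a<len
        ... | here wa≡k = ⊥-elim (avoids-k (a , a<len , 0<a , wa≡k))
        ... | there wa∈ks = wa∈ks
      ... | yes (a , a<len , 0<a , wa≡k) =
        ≤e-trans (⊓-glb (≤e-trans (by-length c i k w₁ I₁ 0<a len₁≤c) (D-into k ks i))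
                        (≤e-trans (by-length c k j w₂ I₂ (ℕₚ.m<n⇒0<n∸m a<len) len₂≤c) (D-from k ks j)))
                 (x≤y⊔x (D ks i j) (D ks i k ⊓ D ks k j))
        where
        a≤len : a ≤ len w
        a≤len = ℕₚ.<⇒≤ a<len
        w₁ : AboveWalks.Walk t i k
        w₁ = AboveWalks.subwalk t w 0 a z≤n a≤len (vertex-0 w) wa≡k
        w₂ : AboveWalks.Walk t k j
        w₂ = AboveWalks.subwalk t w a (len w) a≤len ℕₚ.≤-refl wa≡k (vertex-len w)
        I₁ : AboveWalks.Interior t (_∈ k ∷ ks) w₁
        I₁ = AboveWalks.subwalk-interior t (_∈ k ∷ ks) w 0 a z≤n a≤len (vertex-0 w) wa≡k I
        I₂ : AboveWalks.Interior t (_∈ k ∷ ks) w₂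
        I₂ = AboveWalks.subwalk-interior t (_∈ k ∷ ks) w a (len w) a≤len ℕₚ.≤-refl wa≡k (vertex-len w) I
        len₁≤c : a ≤ c
        len₁≤c = ℕₚ.≤-pred (ℕₚ.<-≤-trans a<len len≤c)
        len₂≤c : len w ∸ a ≤ c
        len₂≤c = ℕₚ.≤-pred (ℕₚ.<-≤-trans (ℕₚ.∸-monoʳ-< 0<a a≤len) len≤c)

    K : Fin n → Fin n → E
    K = D (allFin n)

    K-sym : SymmetricOffDiag K
    K-sym a b _ = D-sym (allFin n) a b

    K-nonneg : NonnegOffDiag K
    K-nonneg a b _ = ≤e-trans (W-nonneg a b) (W≤D (allFin n) a b)

    -- Gluing an optimal walk x → y to an optimal walk y → z.
    K-glue : ∀ x y z → K x y ⊓ K y z ≤e K x z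
    K-glue x y z =
      let t = K x y ⊓ K y z
          (w₁ , _ , nonempty₁) = D-walk (allFin n) t x y (x⊓y≤x (K x y) (K y z))
          (w₂ , _ , _)         = D-walk (allFin n) t y z (x⊓y≤y (K x y) (K y z))
      in walk-D (allFin n) t x z (AboveWalks.concat t w₁ w₂) (λ a _ _ → ∈-allFin _)
                (ℕₚ.≤-trans nonempty₁ (ℕₚ.m≤m+n (len w₁) (len w₂)))

    K-ultra : UltraOffDiag K
    K-ultra x y z _ _ _ with ⊓-sel (K x y) (K y z)
    ... | inj₁ min≡xy = inj₁ (subst (_≤e K x z) min≡xy (K-glue x y z))
    ... | inj₂ min≡yz = inj₂ (subst (_≤e K x z) min≡yz (K-glue x y z))

    H≤K : ∀ i j → ¬ (i ≡ j) → ∀ v → H i j ≡ just v → v ≤e K i j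
    H≤K i j i≢j v Hij = subst (_≤e K i j) (W-defined i j i≢j v Hij) (W≤D (allFin n) i j)

  module Sufficiency {n} (H : PartialMatrix ℝ n) (H-sym : SymmetricPM ℝ H) (H-nonneg : NonnegPM ℝ H)
                     (min-twice : ∀ (C : ChordlessCycle ℝ H) → MinTwice ℝ C) where
    open MaximinClosure H H-sym H-nonneg
    open Walks.Walk

    Heavy : E → Fin n → Fin n → Set
    Heavy t x y = Σ E λ v → H x y ≡ just v × t ≤e v

    module HeavyWalks (t : E) = Walks (Heavy t)

    -- A step above t for W is an edge of G_H, unless its entry is 𝟘 and so t ≤ 𝟘.
    classify-step : ∀ t {x y} → Above t x y → Heavy t x y ⊎ t ≤e 𝟘
    classify-step t {x} {y} t≤W with W-cases x y
    ... | inj₁ W≡𝟘 = inj₂ (subst (t ≤e_) W≡𝟘 t≤W)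
    ... | inj₂ defined = inj₁ (_ , defined , t≤W)

    graph-walk-or-small : ∀ t {i j} → AboveWalks.Walk t i j → HeavyWalks.Walk t i j ⊎ t ≤e 𝟘
    graph-walk-or-small t w with all-or-escape (len w) (λ a a<len → classify-step t (step w a a<len))
    ... | inj₁ heavy = inj₁ (record { len = len w ; vertex = vertex w ; vertex-0 = vertex-0 w
                                    ; vertex-len = vertex-len w ; step = heavy })
    ... | inj₂ small = inj₂ small

    Simple : ∀ {t i j} → HeavyWalks.Walk t i j → Set
    Simple g = ∀ a b → a < b → b ≤ len g → ¬ (vertex g a ≡ vertex g b)

    Chord : ∀ {t i j} → HeavyWalks.Walk t i j → ℕ → ℕ → Set
    Chord g s r = suc s < r × ¬ (s ≡ 0 × r ≡ len g) × ∃ λ y → H (vertex g s) (vertex g r) ≡ just y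

    defined? : (m : Maybe E) → Dec (∃ λ y → m ≡ just y)
    defined? (just y) = yes (y , refl)
    defined? nothing  = no λ ()

    chord? : ∀ {t i j} (g : HeavyWalks.Walk t i j) s r → Dec (Chord g s r)
    chord? g s r =
      (suc s ℕ.<? r) ×-dec ¬? ((s ℕ.≟ 0) ×-dec (r ℕ.≟ len g)) ×-dec defined? (H (vertex g s) (vertex g r))

    -- A simple chordless path i → j of length ≥ 2 in G_H, closed by the edge {i, j},
    -- is a chordless cycle; its two minimal edges cannot both be the closing one.
    module ClosedPath (t : E) {i j} (g : HeavyWalks.Walk t i j) (2≤len : 2 ≤ len g) (simple : Simple g)
                      (chord-free : ∀ s r → s < r → r ≤ len g → ¬ Chord g s r)
                      (i≢j : ¬ (i ≡ j)) (h : E) (Hij : H i j ≡ just h) where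
      L : ℕ
      L = len g
      open Cyclic L

      v : Fin (suc L) → Fin n
      v a = vertex g (toℕ a)

      w : Fin (suc L) → E
      w a = entry (H (v a) (v (next ℝ a)))

      position : ∀ (a : Fin (suc L)) → toℕ a < L ⊎ toℕ a ≡ L
      position a = ℕₚ.m≤n⇒m<n∨m≡n (ℕₚ.≤-pred (Finₚ.toℕ<n a))

      path-edge : ∀ a → toℕ a < L → H (v a) (v (next ℝ a)) ≡ just (w a) × t ≤e w a
      path-edge a a<L with step g (toℕ a) a<L
      ... | x , Hx , t≤x = defined-entry H-next , subst (t ≤e_) (sym (cong entry H-next)) t≤x
        where
        H-next : H (v a) (v (next ℝ a)) ≡ just x
        H-next = subst (λ y → H (v a) y ≡ just x) (sym (cong (vertex g) (next-inner a a<L))) Hx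

      closing-edge : ∀ a → toℕ a ≡ L → H (v a) (v (next ℝ a)) ≡ just h
      closing-edge a a≡L = subst₂ (λ x y → H x y ≡ just h)
        (sym (trans (cong (vertex g) a≡L) (vertex-len g))) (sym (trans (cong (vertex g) (next-last a a≡L)) (vertex-0 g)))
        (trans (H-sym j i (i≢j ∘ sym)) Hij)

      edge : ∀ a → H (v a) (v (next ℝ a)) ≡ just (w a)
      edge a with position a
      ... | inj₁ a<L = proj₁ (path-edge a a<L)
      ... | inj₂ a≡L = defined-entry (closing-edge a a≡L)

      v-inj : ∀ a b → v a ≡ v b → a ≡ b
      v-inj a b va≡vb with ℕₚ.<-cmp (toℕ a) (toℕ b)
      ... | tri< a<b _ _ = ⊥-elim (simple (toℕ a) (toℕ b) a<b (ℕₚ.≤-pred (Finₚ.toℕ<n b)) va≡vb)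
      ... | tri≈ _ a≡b _ = Finₚ.toℕ-injective a≡b
      ... | tri> _ _ b<a = ⊥-elim (simple (toℕ b) (toℕ a) b<a (ℕₚ.≤-pred (Finₚ.toℕ<n a)) (sym va≡vb))

      non-adjacent : ∀ a b → toℕ a < toℕ b → ¬ (b ≡ next ℝ a) → ¬ (a ≡ next ℝ b) →
                     H (v a) (v b) ≡ nothing
      non-adjacent a b a<b b≢next-a a≢next-b with H (v a) (v b) in Hab
      ... | nothing = refl
      ... | just y = ⊥-elim (chord-free (toℕ a) (toℕ b) a<b b≤L (gap , not-closing , y , Hab))
        where
        b≤L : toℕ b ≤ L
        b≤L = ℕₚ.≤-pred (Finₚ.toℕ<n b)
        gap : suc (toℕ a) < toℕ b
        gap = ℕₚ.≤∧≢⇒< a<b (λ eq → b≢next-a (Finₚ.toℕ-injective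
                                   (trans (sym eq) (sym (next-inner a (ℕₚ.<-≤-trans a<b b≤L))))))
        not-closing : ¬ (toℕ a ≡ 0 × toℕ b ≡ L)
        not-closing (a≡0 , b≡L) = a≢next-b (Finₚ.toℕ-injective (trans a≡0 (sym (next-last b b≡L))))

      chordless : ∀ a b → ¬ (a ≡ b) → ¬ (b ≡ next ℝ a) → ¬ (a ≡ next ℝ b) → H (v a) (v b) ≡ nothing
      chordless a b a≢b b≢next-a a≢next-b with ℕₚ.<-cmp (toℕ a) (toℕ b)
      ... | tri< a<b _ _ = non-adjacent a b a<b b≢next-a a≢next-b
      ... | tri≈ _ a≡b _ = ⊥-elim (a≢b (Finₚ.toℕ-injective a≡b))
      ... | tri> _ _ b<a = trans (H-sym (v a) (v b) (a≢b ∘ v-inj a b)) (non-adjacent b a b<a a≢next-b b≢next-a)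

      cycle : ChordlessCycle ℝ H
      cycle = record { m = L ; len≥3 = s≤s 2≤len ; v = v ; v-inj = v-inj ; w = w ; edge = edge ; chordless = chordless }

      bound-via : ∀ a → toℕ a < L → (∀ c → w a ≤e w c) → t ≤e h
      bound-via a a<L a-min = ≤e-trans (proj₂ (path-edge a a<L)) (subst (w a ≤e_) w-last (a-min last))
        where
        last : Fin (suc L)
        last = Fin.fromℕ L
        w-last : w last ≡ h
        w-last = cong entry (closing-edge last (Finₚ.toℕ-fromℕ L))

      bound : t ≤e h
      bound with min-twice cycle
      ... | a₁ , a₂ , a₁≢a₂ , a₁-min , a₂-min with position a₁ | position a₂
      ...   | inj₁ a₁<L | _         = bound-via a₁ a₁<L a₁-min
      ...   | inj₂ _    | inj₁ a₂<L = bound-via a₂ a₂<L a₂-min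
      ...   | inj₂ a₁≡L | inj₂ a₂≡L = ⊥-elim (a₁≢a₂ (Finₚ.toℕ-injective (trans a₁≡L (sym a₂≡L))))

    -- The
    -- proof is by induction on the length: cut out repeated vertices, shortcut chords
    -- (bounding the chord's weight by the same argument), and use the hypothesis on
    -- the chordless cycle that remains.
    BoundedUpTo : E → ℕ → Set
    BoundedUpTo t c = ∀ {i j} (g : HeavyWalks.Walk t i j) → len g ≤ c →
                      ¬ (i ≡ j) → ∀ h → H i j ≡ just h → t ≤e h

    empty-walk : ∀ {t i j} (g : HeavyWalks.Walk t i j) → len g ≡ 0 → i ≡ j
    empty-walk g len≡0 = trans (sym (vertex-0 g)) (trans (cong (vertex g) (sym len≡0)) (vertex-len g))

    bound-edge : ∀ t {i j} (g : HeavyWalks.Walk t i j) → len g ≡ 1 → ∀ h → H i j ≡ just h → t ≤e h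
    bound-edge t g len≡1 h Hij with step g 0 (subst (0 <_) (sym len≡1) (s≤s z≤n))
    ... | x , Hx , t≤x = subst (t ≤e_) (just-injective (trans (sym H-ij) Hij)) t≤x
      where
      H-ij : H _ _ ≡ just x
      H-ij = subst₂ (λ p q → H p q ≡ just x) (vertex-0 g) (trans (cong (vertex g) (sym len≡1)) (vertex-len g)) Hx

    bound-repeat : ∀ t c → BoundedUpTo t c → ∀ {i j} (g : HeavyWalks.Walk t i j) → len g ≤ suc c →
                   ¬ (i ≡ j) → ∀ h → H i j ≡ just h →
                   ∀ a b → a < b → b ≤ len g → vertex g a ≡ vertex g b → t ≤e h
    bound-repeat t c IH g len≤c i≢j h Hij a b a<b b≤len repeat
      with HeavyWalks.excise t g a b (ℕₚ.<⇒≤ a<b) b≤len repeat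
    ... | g′ , refl = IH g′ shorter i≢j h Hij
      where
      shorter : a + (len g ∸ b) ≤ c
      shorter = ℕₚ.≤-pred (ℕₚ.≤-trans (subst (a + (len g ∸ b) <_) (ℕₚ.m+[n∸m]≡n b≤len)
                                             (ℕₚ.+-monoˡ-< (len g ∸ b) a<b)) len≤c)

    -- The stretch of a simple walk spanned by a chord is shorter than the walk and
    -- joins distinct vertices, so it bounds the chord's weight.
    chord-weight : ∀ t c → BoundedUpTo t c → ∀ {i j} (g : HeavyWalks.Walk t i j) → len g ≤ suc c → Simple g →
                   ∀ s r → s < r → r ≤ len g → ¬ (s ≡ 0 × r ≡ len g) →
                   ∀ y → H (vertex g s) (vertex g r) ≡ just y → t ≤e y
    chord-weight t c IH g len≤c simple s r s<r r≤len not-closing y Hsr =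
      IH (HeavyWalks.subwalk t g s r (ℕₚ.<⇒≤ s<r) r≤len refl refl)
         (ℕₚ.≤-pred (ℕₚ.≤-trans (stretch<len s s<r not-closing) len≤c)) (simple s r s<r r≤len) y Hsr
      where
      stretch<len : ∀ s → s < r → ¬ (s ≡ 0 × r ≡ len g) → r ∸ s < len g
      stretch<len zero    _   not-closing = ℕₚ.≤∧≢⇒< r≤len (λ r≡len → not-closing (refl , r≡len))
      stretch<len (suc s) s<r _ = ℕₚ.<-≤-trans (ℕₚ.∸-monoʳ-< (s≤s z≤n) (ℕₚ.<⇒≤ s<r)) r≤len

    bound-chord : ∀ t c → BoundedUpTo t c → ∀ {i j} (g : HeavyWalks.Walk t i j) → len g ≤ suc c → Simple g →
                  ¬ (i ≡ j) → ∀ h → H i j ≡ just h → ∀ s r → s < r → r ≤ len g → Chord g s r → t ≤e h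
    bound-chord t c IH g len≤c simple i≢j h Hij s r s<r r≤len (gap , not-closing , y , Hsr)
      with HeavyWalks.bypass t g s r (ℕₚ.<⇒≤ s<r) r≤len
             (y , Hsr , chord-weight t c IH g len≤c simple s r s<r r≤len not-closing y Hsr)
    ... | g′ , refl = IH g′ (ℕₚ.≤-pred (ℕₚ.≤-trans shorter len≤c)) i≢j h Hij
      where
      shorter : s + suc (len g ∸ r) < len g
      shorter = subst (_< len g) (sym (ℕₚ.+-suc s (len g ∸ r)))
                      (subst (suc s + (len g ∸ r) <_) (ℕₚ.m+[n∸m]≡n r≤len) (ℕₚ.+-monoˡ-< (len g ∸ r) gap))

    -- A simple walk of length ≥ 2 either has a chord or closes to a chordless cycle.
    bound-simple : ∀ t c → BoundedUpTo t c → ∀ {i j} (g : HeavyWalks.Walk t i j) → len g ≤ suc c → Simple g →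
                   ¬ (i ≡ j) → ∀ h → H i j ≡ just h → t ≤e h
    bound-simple t c IH g len≤c simple i≢j h Hij = by-length (len g) refl
      where
      by-length : ∀ L → len g ≡ L → t ≤e h
      by-length zero len≡0 = ⊥-elim (i≢j (empty-walk g len≡0))
      by-length (suc zero) len≡1 = bound-edge t g len≡1 h Hij
      by-length (suc (suc _)) len≡2+ with anyPairUpTo? (chord? g) (len g)
      ... | yes (s , r , s<r , r≤len , chord) = bound-chord t c IH g len≤c simple i≢j h Hij s r s<r r≤len chord
      ... | no chord-free = ClosedPath.bound t g (subst (2 ≤_) (sym len≡2+) (s≤s (s≤s z≤n))) simple
                              (λ s r s<r r≤len chord → chord-free (s , r , s<r , r≤len , chord)) i≢j h Hij

    walk-bound : ∀ t c → BoundedUpTo t c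
    walk-bound t zero g len≤0 i≢j h Hij = ⊥-elim (i≢j (empty-walk g (ℕₚ.n≤0⇒n≡0 len≤0)))
    walk-bound t (suc c) g len≤c i≢j h Hij with anyPairUpTo? (λ a b → vertex g a ≟ vertex g b) (len g)
    ... | yes (a , b , a<b , b≤len , repeat) = bound-repeat t c (walk-bound t c) g len≤c i≢j h Hij a b a<b b≤len repeat
    ... | no no-repeat = bound-simple t c (walk-bound t c) g len≤c simple i≢j h Hij
      where
      simple : Simple g
      simple a b a<b b≤len repeat = no-repeat (a , b , a<b , b≤len , repeat)

    K-agrees : ∀ i j → ¬ (i ≡ j) → ∀ v → H i j ≡ just v → K i j ≡ v
    K-agrees i j i≢j v Hij = ≤e-antisym K≤v (H≤K i j i≢j v Hij)
      where
      K≤v : K i j ≤e v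
      K≤v with graph-walk-or-small (K i j) (proj₁ (D-walk (allFin n) (K i j) i j ≤e-refl))
      ... | inj₁ g   = walk-bound (K i j) (len g) g ℕₚ.≤-refl i≢j v Hij
      ... | inj₂ K≤𝟘 = ≤e-trans K≤𝟘 (H-nonneg i j i≢j v Hij)

    completable : Completable ℝ H
    completable = K , K-sym , K-agrees , (λ _ → 0#) , ultra⇒M♮-convex (λ _ → 0#) K K-sym K-nonneg K-ultra

theorem2 : (ℝ : RealField) (n : ℕ) → 2 ≤ n → (H : PartialMatrix ℝ n) →
    SymmetricPM ℝ H → NonnegPM ℝ H → UltraPM ℝ H →
    (Completable ℝ H ⇔ (∀ (C : ChordlessCycle ℝ H) → MinTwice ℝ C))
theorem2 ℝ n _ H H-sym H-nonneg _ =
  mk⇔ (completable⇒min-twice ℝ H) (Sufficiency.completable ℝ H H-sym H-nonneg)
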